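{- (Primitive Decomposition.) Let $A$ be an integer weighing matrix, i.e. $A\in\mathbb Z^{n\times n}$ with $AA^\top=kI$ for some integer $k$. Then $A$ is H-equivalent to a block diagonal sum $A_1\oplus\cdots\oplus A_r$ of primitive integer weighing matrices. This decomposition is unique in the following sense: if $A_1\oplus\cdots\oplus A_r\sim_H A'_1\oplus\cdots\oplus A'_s$ with all $A_i,A'_j$ primitive integer weighing matrices, then $r=s$ and there is a permutation $\pi\in S_r$ such that $A_i\sim_H A'_{\pi(i)}$ for all $i$.
   Context: $\mathrm{Mon}(n)$ denotes the set of $n\times n$ monomial matrices with entries in $\{0,1,-1\}$ (exactly one nonzero entry in each row and column). Two integer matrices $A,B$ of the same size $m\times n$ are H-equivalent, written $A\sim_H B$, if $B=LAR^\top$ for some $L\in\mathrm{Mon}(m)$, $R\in\mathrm{Mon}(n)$ (equivalently, $B$ is obtained from $A$ by permuting and negating rows and columns). $X\oplus Y$ denotes the block diagonal sum of square matrices. An integer weighing matrix $A$ is primitive if it is not H-equivalent to a block diagonal sum of two or more smaller square blocks. -}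

module Defs where

open import Data.Nat as ℕ using (ℕ; zero; suc)
open import Data.Integer using (ℤ; 0ℤ; 1ℤ; -1ℤ; _+_; _*_)
open import Data.Fin using (Fin; zero; suc; splitAt; cast)
open import Data.Sum using (_⊎_; inj₁; inj₂)
open import Data.Product using (Σ; ∃; _×_; _,_; proj₁; proj₂)
open import Relation.Binary.PropositionalEquality using (_≡_; _≢_)
open import Relation.Nullary using (¬_)

Mat : ℕ → ℕ → Set
Mat m n = Fin m → Fin n → ℤ

Σℤ : ∀ n → (Fin n → ℤ) → ℤ
Σℤ zero    f = 0ℤ
Σℤ (suc n) f = f zero + Σℤ n (λ i → f (suc i))

_·_ : ∀ {m n p} → Mat m n → Mat n p → Mat m p
_·_ {n = n} A B i j = Σℤ n (λ l → A i l * B l j)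

_ᵀ : ∀ {m n} → Mat m n → Mat n m
(A ᵀ) i j = A j i

_≋_ : ∀ {m n} → Mat m n → Mat m n → Set
A ≋ B = ∀ i j → A i j ≡ B i j

scalarI : ∀ {n} → ℤ → Mat n n
scalarI k i j with i Data.Fin.≟ j
... | Relation.Nullary.yes _ = k
... | Relation.Nullary.no  _ = 0ℤ

IsWeighing : ∀ {n} → Mat n n → Set
IsWeighing A = ∃ λ (k : ℤ) → (A · (A ᵀ)) ≋ scalarI k

IsMonomial : ∀ {n} → Mat n n → Set
IsMonomial {n} M =
  (∀ i j → (M i j ≡ 0ℤ) ⊎ ((M i j ≡ 1ℤ) ⊎ (M i j ≡ -1ℤ)))
  × (∀ i → Σ (Fin n) λ j → (M i j ≢ 0ℤ) × (∀ j' → M i j' ≢ 0ℤ → j' ≡ j))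
  × (∀ j → Σ (Fin n) λ i → (M i j ≢ 0ℤ) × (∀ i' → M i' j ≢ 0ℤ → i' ≡ i))

_∼H_ : ∀ {m n} → Mat m n → Mat m n → Set
_∼H_ {m} {n} A B = Σ (Mat m m) λ L → Σ (Mat n n) λ R →
  IsMonomial L × IsMonomial R × (B ≋ ((L · A) · (R ᵀ)))

-- H-equivalence of square matrices whose sizes are only propositionally equal
_∼H′_ : ∀ {m n} → Mat m m → Mat n n → Set
_∼H′_ {m} {n} A B = Σ (m ≡ n) λ e → A ∼H (λ i j → B (cast e i) (cast e j))

_⊕_ : ∀ {m n} → Mat m m → Mat n n → Mat (m ℕ.+ n) (m ℕ.+ n)
_⊕_ {m} {n} X Y i j with splitAt m i | splitAt m j
... | inj₁ a | inj₁ b = X a b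
... | inj₂ a | inj₂ b = Y a b
... | inj₁ _ | inj₂ _ = 0ℤ
... | inj₂ _ | inj₁ _ = 0ℤ

Block : Set
Block = Σ ℕ λ m → Mat m m

size : Block → ℕ
size = proj₁

mat : (b : Block) → Mat (size b) (size b)
mat = proj₂

totalSize : ∀ r → (Fin r → Block) → ℕ
totalSize zero    bs = 0
totalSize (suc r) bs = size (bs zero) ℕ.+ totalSize r (λ i → bs (suc i))

⨁ : ∀ r → (bs : Fin r → Block) → Mat (totalSize r bs) (totalSize r bs)
⨁ zero    bs ()
⨁ (suc r) bs = mat (bs zero) ⊕ ⨁ r (λ i → bs (suc i))

Primitive : ∀ {n} → Mat n n → Set
Primitive {n} A =
  (1 ℕ.≤ n) ×
  ¬ (Σ ℕ λ r → Σ (Fin r → Block) λ bs →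
       (2 ℕ.≤ r) × (∀ i → size (bs i) ℕ.< n) × (A ∼H′ ⨁ r bs))

PrimWeighing : Block → Set
PrimWeighing b = IsWeighing (mat b) × Primitive (mat b)

{-# OPTIONS --safe #-}
-- A separation of an n×n matrix A is a pair of row and column sets of the same size c,
-- 0 < c < n, such that every nonzero entry lies in a chosen row iff it lies in a chosen
-- column.  A has a separation of size c exactly when A ∼H X ⊕ Y with X of size c, and
-- having one is decidable.  Existence: split off a separation of least size, whose left
-- block is then primitive, and recurse on the right block.
--
-- Uniqueness: let E be an H-equivalence between two block sums of primitive weighing
-- matrices.  Label the rows and columns of a block X of weight k ≠ 0 by the block of the
-- other sum that E sends them to; a nonzero entry joins a row and a column with the same
-- label.  The rows P and columns Q carrying one label satisfy k·|P| = k·|Q|, since both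
-- sides sum the squared entries in those rows (using the column norms XᵀX = kI), so by
-- primitivity they are all of X.  A primitive block of weight 0 is the 1×1 zero matrix,
-- and its row lands in a block with a zero row, which is again a 1×1 zero block.  The
-- resulting matching of blocks is a bijection between H-equivalent blocks.

module Submission where

open import Defs
open import Data.Nat using (ℕ)
open import Data.Fin using (Fin; cast)
open import Data.Fin.Permutation using (Permutation′; _⟨$⟩ʳ_)
open import Data.Product using (Σ; _×_)
open import Relation.Binary.PropositionalEquality using (_≡_)

import Algebra.Properties.Semiring.Sum as SemiringSum
open import Data.Bool as Bool using (Bool; true; false; not)
open import Data.Empty using (⊥-elim)
open import Data.Fin as F using (zero; suc; splitAt; join; _↑ˡ_; _↑ʳ_; punchIn)
import Data.Fin.Properties as FP
open import Data.Fin.Permutation as Perm using (Permutation; permutation; _⟨$⟩ˡ_)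
open import Data.Fin.Subset.Properties using (anySubset?)
open import Data.Integer as ℤ using (ℤ; +_; 0ℤ; 1ℤ; -1ℤ; _+_; _*_; -_; _-_)
import Data.Integer.Properties as ℤP
open import Data.Integer.Tactic.RingSolver using (solve-∀)
open import Data.Nat as ℕ using (zero; suc; z≤n; s≤s)
open import Data.Nat.Induction using (<-rec)
import Data.Nat.Properties as ℕP
open import Data.Product using (∃; _,_; proj₁; proj₂)
open import Data.Sum as ⊎ using (_⊎_; inj₁; inj₂; [_,_])
open import Data.Sum.Algebra using (⊎-assoc; ⊎-comm)
open import Data.Sum.Function.Propositional using (_⊎-↔_)
open import Data.Vec using (lookup; tabulate)
open import Data.Vec.Functional using (_∷_)
open import Data.Vec.Properties using (lookup∘tabulate)
open import Function using (_∘_; case_of_)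
open import Function.Bundles using (Inverse; Injection; _↔_; mk↔ₛ′)
open import Function.Properties.Inverse using (↔-refl; ↔-sym; ↔-trans; ↔⇒↣)
open import Level using (0ℓ)
open import Relation.Binary.Definitions using (DecidableEquality)
open import Relation.Binary.PropositionalEquality
  using (refl; sym; trans; cong; cong₂; subst; subst₂; _≢_; module ≡-Reasoning)
open import Relation.Nullary using (¬_; Dec; yes; no; ¬?; _×-dec_; _→-dec_)
import Relation.Nullary.Decidable as Dec

-- Finite sums over Fin n

module ∑ℤ = SemiringSum ℤP.+-*-semiring

Σℤ≡sum : ∀ n (f : Fin n → ℤ) → Σℤ n f ≡ ∑ℤ.sum f
Σℤ≡sum zero    f = refl
Σℤ≡sum (suc n) f = cong (_+_ (f zero)) (Σℤ≡sum n (f ∘ suc))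

Σℤ-cong : ∀ n {f g : Fin n → ℤ} → (∀ i → f i ≡ g i) → Σℤ n f ≡ Σℤ n g
Σℤ-cong n {f} {g} f≗g = trans (Σℤ≡sum n f) (trans (∑ℤ.sum-cong-≗ f≗g) (sym (Σℤ≡sum n g)))

Σℤ-zero : ∀ n {f : Fin n → ℤ} → (∀ i → f i ≡ 0ℤ) → Σℤ n f ≡ 0ℤ
Σℤ-zero n f≗0 = trans (Σℤ-cong n f≗0) (trans (Σℤ≡sum n _) (∑ℤ.sum-replicate-zero n))

Σℤ-distrib-+ : ∀ n (f g : Fin n → ℤ) → Σℤ n (λ i → f i + g i) ≡ Σℤ n f + Σℤ n g
Σℤ-distrib-+ n f g = begin
  Σℤ n (λ i → f i + g i)    ≡⟨ Σℤ≡sum n _ ⟩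
  ∑ℤ.sum (λ i → f i + g i)  ≡⟨ ∑ℤ.∑-distrib-+ f g ⟩
  ∑ℤ.sum f + ∑ℤ.sum g       ≡⟨ sym (cong₂ _+_ (Σℤ≡sum n f) (Σℤ≡sum n g)) ⟩
  Σℤ n f + Σℤ n g           ∎
  where open ≡-Reasoning

*-distribˡ-Σℤ : ∀ n c (f : Fin n → ℤ) → c * Σℤ n f ≡ Σℤ n (λ i → c * f i)
*-distribˡ-Σℤ n c f = begin
  c * Σℤ n f                 ≡⟨ cong (c *_) (Σℤ≡sum n f) ⟩
  c * ∑ℤ.sum f               ≡⟨ ∑ℤ.*-distribˡ-sum c f ⟩
  ∑ℤ.sum (λ i → c * f i)     ≡⟨ sym (Σℤ≡sum n _) ⟩
  Σℤ n (λ i → c * f i)       ∎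
  where open ≡-Reasoning

*-distribʳ-Σℤ : ∀ n c (f : Fin n → ℤ) → Σℤ n f * c ≡ Σℤ n (λ i → f i * c)
*-distribʳ-Σℤ n c f = begin
  Σℤ n f * c                 ≡⟨ cong (_* c) (Σℤ≡sum n f) ⟩
  ∑ℤ.sum f * c               ≡⟨ ∑ℤ.*-distribʳ-sum c f ⟩
  ∑ℤ.sum (λ i → f i * c)     ≡⟨ sym (Σℤ≡sum n _) ⟩
  Σℤ n (λ i → f i * c)       ∎
  where open ≡-Reasoning

Σℤ-comm : ∀ m n (f : Fin m → Fin n → ℤ) →
          Σℤ m (λ i → Σℤ n (f i)) ≡ Σℤ n (λ j → Σℤ m (λ i → f i j))
Σℤ-comm m n f = begin
  Σℤ m (λ i → Σℤ n (f i))                  ≡⟨ Σℤ-cong m (λ i → Σℤ≡sum n (f i)) ⟩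
  Σℤ m (λ i → ∑ℤ.sum (f i))                ≡⟨ Σℤ≡sum m _ ⟩
  ∑ℤ.sum (λ i → ∑ℤ.sum (f i))              ≡⟨ ∑ℤ.∑-comm f ⟩
  ∑ℤ.sum (λ j → ∑ℤ.sum (λ i → f i j))      ≡⟨ sym (Σℤ≡sum n _) ⟩
  Σℤ n (λ j → ∑ℤ.sum (λ i → f i j))        ≡⟨ sym (Σℤ-cong n (λ j → Σℤ≡sum m (λ i → f i j))) ⟩
  Σℤ n (λ j → Σℤ m (λ i → f i j))          ∎
  where open ≡-Reasoning

Σℤ-permute : ∀ {m n} (π : Permutation m n) (f : Fin n → ℤ) →
             Σℤ n f ≡ Σℤ m (λ i → f (π ⟨$⟩ʳ i))
Σℤ-permute {m} {n} π f =
  trans (Σℤ≡sum n f) (trans (∑ℤ.sum-permute f π) (sym (Σℤ≡sum m _)))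

Σℤ-single : ∀ n (f : Fin n → ℤ) p → (∀ i → i ≢ p → f i ≡ 0ℤ) → Σℤ n f ≡ f p
Σℤ-single (suc n) f p others = begin
  Σℤ (suc n) f                        ≡⟨ Σℤ≡sum (suc n) f ⟩
  ∑ℤ.sum f                            ≡⟨ ∑ℤ.sum-remove f ⟩
  f p + ∑ℤ.sum (f ∘ punchIn p)        ≡⟨ cong (_+_ (f p)) (sym (Σℤ≡sum n _)) ⟩
  f p + Σℤ n (f ∘ punchIn p)          ≡⟨ cong (_+_ (f p)) (Σℤ-zero n (λ i → others _ (FP.punchInᵢ≢i p i))) ⟩
  f p + 0ℤ                            ≡⟨ ℤP.+-identityʳ (f p) ⟩
  f p                                 ∎
  where open ≡-Reasoning

Σℤ-splitAt : ∀ m n (f : Fin (m ℕ.+ n) → ℤ) →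
             Σℤ (m ℕ.+ n) f ≡ Σℤ m (λ i → f (i ↑ˡ n)) + Σℤ n (λ j → f (m ↑ʳ j))
Σℤ-splitAt zero    n f = sym (ℤP.+-identityˡ _)
Σℤ-splitAt (suc m) n f =
  trans (cong (_+_ (f zero)) (Σℤ-splitAt m n (f ∘ suc))) (sym (ℤP.+-assoc (f zero) _ _))

Σℤ-nonneg : ∀ n (f : Fin n → ℤ) → (∀ i → 0ℤ ℤ.≤ f i) → 0ℤ ℤ.≤ Σℤ n f
Σℤ-nonneg zero    f f≥0 = ℤP.≤-refl
Σℤ-nonneg (suc n) f f≥0 = ℤP.+-mono-≤ (f≥0 zero) (Σℤ-nonneg n (f ∘ suc) (f≥0 ∘ suc))

nonneg+nonneg≡0 : ∀ {a b} → 0ℤ ℤ.≤ a → 0ℤ ℤ.≤ b → a + b ≡ 0ℤ → a ≡ 0ℤ × b ≡ 0ℤ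
nonneg+nonneg≡0 {a} {b} 0≤a 0≤b a+b≡0 = a≡0 , b≡0
  where
  a≤a+b : a ℤ.≤ a + b
  a≤a+b = subst (ℤ._≤ a + b) (ℤP.+-identityʳ a) (ℤP.+-monoʳ-≤ a 0≤b)
  a≡0 : a ≡ 0ℤ
  a≡0 = ℤP.≤-antisym (subst (a ℤ.≤_) a+b≡0 a≤a+b) 0≤a
  b≡0 : b ≡ 0ℤ
  b≡0 = trans (sym (ℤP.+-identityˡ b)) (trans (cong (_+ b) (sym a≡0)) a+b≡0)

Σℤ-nonneg-≡0 : ∀ n (f : Fin n → ℤ) → (∀ i → 0ℤ ℤ.≤ f i) → Σℤ n f ≡ 0ℤ → ∀ i → f i ≡ 0ℤ
Σℤ-nonneg-≡0 (suc n) f f≥0 Σf≡0 i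
  with nonneg+nonneg≡0 (f≥0 zero) (Σℤ-nonneg n (f ∘ suc) (f≥0 ∘ suc)) Σf≡0
Σℤ-nonneg-≡0 (suc n) f f≥0 Σf≡0 zero    | f₀≡0 , _      = f₀≡0
Σℤ-nonneg-≡0 (suc n) f f≥0 Σf≡0 (suc i) | _    , rest≡0 = Σℤ-nonneg-≡0 n (f ∘ suc) (f≥0 ∘ suc) rest≡0 i

Σℤ-distrib-- : ∀ n (f g : Fin n → ℤ) → Σℤ n (λ i → f i - g i) ≡ Σℤ n f - Σℤ n g
Σℤ-distrib-- n f g = trans (Σℤ-distrib-+ n f (λ i → - g i)) (cong (_+_ (Σℤ n f)) Σ-g)
  where
  Σ-g : Σℤ n (λ i → - g i) ≡ - Σℤ n g
  Σ-g = begin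
    Σℤ n (λ i → - g i)        ≡⟨ Σℤ-cong n (λ i → sym (ℤP.-1*i≡-i (g i))) ⟩
    Σℤ n (λ i → -1ℤ * g i)    ≡⟨ sym (*-distribˡ-Σℤ n -1ℤ g) ⟩
    -1ℤ * Σℤ n g              ≡⟨ ℤP.-1*i≡-i _ ⟩
    - Σℤ n g                  ∎
    where open ≡-Reasoning

Σℤ-*-Σℤ : ∀ m n (f : Fin m → ℤ) (g : Fin n → ℤ) →
          Σℤ m f * Σℤ n g ≡ Σℤ m (λ i → Σℤ n (λ j → f i * g j))
Σℤ-*-Σℤ m n f g =
  trans (*-distribʳ-Σℤ m (Σℤ n g) f) (Σℤ-cong m (λ i → *-distribˡ-Σℤ n (f i) g))

ΣΣ : ∀ n → (Fin n → Fin n → ℤ) → ℤ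
ΣΣ n f = Σℤ n (λ j → Σℤ n (f j))

ΣΣ-cong : ∀ n {f g : Fin n → Fin n → ℤ} → (∀ i j → f i j ≡ g i j) → ΣΣ n f ≡ ΣΣ n g
ΣΣ-cong n f≗g = Σℤ-cong n (λ i → Σℤ-cong n (f≗g i))

ΣΣ-distrib-- : ∀ n (f g : Fin n → Fin n → ℤ) → ΣΣ n (λ i j → f i j - g i j) ≡ ΣΣ n f - ΣΣ n g
ΣΣ-distrib-- n f g = trans (Σℤ-cong n (λ i → Σℤ-distrib-- n (f i) (g i))) (Σℤ-distrib-- n _ _)

ΣΣ-ΣΣ-comm : ∀ m n (F : Fin n → Fin n → Fin m → Fin m → ℤ) →
             ΣΣ n (λ j l → ΣΣ m (F j l)) ≡ ΣΣ m (λ i i′ → ΣΣ n (λ j l → F j l i i′))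
ΣΣ-ΣΣ-comm m n F = begin
  Σℤ n (λ j → Σℤ n (λ l → Σℤ m (λ i → Σℤ m (F j l i))))
    ≡⟨ Σℤ-cong n (λ j → Σℤ-comm n m (λ l i → Σℤ m (F j l i))) ⟩
  Σℤ n (λ j → Σℤ m (λ i → Σℤ n (λ l → Σℤ m (F j l i))))
    ≡⟨ Σℤ-cong n (λ j → Σℤ-cong m (λ i → Σℤ-comm n m (λ l → F j l i))) ⟩
  Σℤ n (λ j → Σℤ m (λ i → Σℤ m (λ i′ → Σℤ n (λ l → F j l i i′))))
    ≡⟨ Σℤ-comm n m _ ⟩
  Σℤ m (λ i → Σℤ n (λ j → Σℤ m (λ i′ → Σℤ n (λ l → F j l i i′))))
    ≡⟨ Σℤ-cong m (λ i → Σℤ-comm n m _) ⟩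
  Σℤ m (λ i → Σℤ m (λ i′ → Σℤ n (λ j → Σℤ n (λ l → F j l i i′))))  ∎
  where open ≡-Reasoning

sq-nonneg : ∀ x → 0ℤ ℤ.≤ x * x
sq-nonneg (+ zero)   = ℤ.+≤+ z≤n
sq-nonneg (+ suc n)  = ℤ.+≤+ z≤n
sq-nonneg ℤ.-[1+ n ] = ℤ.+≤+ z≤n

sq≡0⇒≡0 : ∀ x → x * x ≡ 0ℤ → x ≡ 0ℤ
sq≡0⇒≡0 x x²≡0 with ℤP.i*j≡0⇒i≡0∨j≡0 x x²≡0
... | inj₁ x≡0 = x≡0
... | inj₂ x≡0 = x≡0

*-zeroʳ₂ : ∀ s t → s * (t * 0ℤ) ≡ 0ℤ
*-zeroʳ₂ s t = trans (cong (s *_) (ℤP.*-zeroʳ t)) (ℤP.*-zeroʳ s)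

-- Counting Boolean predicates on Fin n

module ∑ℕ = SemiringSum ℕP.+-*-semiring

indicator : Bool → ℕ
indicator true  = 1
indicator false = 0

count : ∀ {n} → (Fin n → Bool) → ℕ
count P = ∑ℕ.sum (indicator ∘ P)

count-cong : ∀ {n} {P Q : Fin n → Bool} → (∀ i → P i ≡ Q i) → count P ≡ count Q
count-cong P≗Q = ∑ℕ.sum-cong-≗ (cong indicator ∘ P≗Q)

count-permute : ∀ {m n} (π : Permutation m n) (P : Fin n → Bool) → count P ≡ count (λ i → P (π ⟨$⟩ʳ i))
count-permute π P = ∑ℕ.sum-permute (indicator ∘ P) π

count-splitAt : ∀ m n (P : Fin (m ℕ.+ n) → Bool) →
                count P ≡ count (λ i → P (i ↑ˡ n)) ℕ.+ count (λ j → P (m ↑ʳ j))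
count-splitAt zero    n P = refl
count-splitAt (suc m) n P =
  trans (cong (indicator (P zero) ℕ.+_) (count-splitAt m n (P ∘ suc))) (sym (ℕP.+-assoc (indicator (P zero)) _ _))

count-false : ∀ n → count {n} (λ _ → false) ≡ 0
count-false n = ∑ℕ.sum-replicate-zero n

count-true : ∀ n → count {n} (λ _ → true) ≡ n
count-true zero    = refl
count-true (suc n) = cong suc (count-true n)

count≤n : ∀ {n} (P : Fin n → Bool) → count P ℕ.≤ n
count≤n {zero}  P = z≤n
count≤n {suc n} P with P zero
... | true  = s≤s (count≤n (P ∘ suc))
... | false = ℕP.m≤n⇒m≤1+n (count≤n (P ∘ suc))

count≡n⇒true : ∀ {n} (P : Fin n → Bool) → count P ≡ n → ∀ i → P i ≡ true
count≡n⇒true {suc n} P #P≡n i with P zero in P₀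
count≡n⇒true {suc n} P #P≡n zero    | true  = P₀
count≡n⇒true {suc n} P #P≡n (suc i) | true  = count≡n⇒true (P ∘ suc) (ℕP.suc-injective #P≡n) i
count≡n⇒true {suc n} P #P≡n i       | false = ⊥-elim (ℕP.<-irrefl #P≡n (s≤s (count≤n (P ∘ suc))))

true⇒count-pos : ∀ {n} (P : Fin n → Bool) {i} → P i ≡ true → 1 ℕ.≤ count P
true⇒count-pos {suc n} P {zero}  Pi rewrite Pi = s≤s z≤n
true⇒count-pos {suc n} P {suc i} Pi =
  ℕP.≤-trans (true⇒count-pos (P ∘ suc) Pi) (ℕP.m≤n+m _ (indicator (P zero)))

count+count-not : ∀ {n} (P : Fin n → Bool) → count P ℕ.+ count (not ∘ P) ≡ n
count+count-not {zero}  P = refl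
count+count-not {suc n} P with P zero
... | true  = cong suc (count+count-not (P ∘ suc))
... | false = trans (ℕP.+-suc (count (P ∘ suc)) _) (cong suc (count+count-not (P ∘ suc)))

Σℤ-indicator : ∀ n (P : Fin n → Bool) → Σℤ n (λ i → + indicator (P i)) ≡ + count P
Σℤ-indicator zero    P = refl
Σℤ-indicator (suc n) P = cong (_+_ (+ indicator (P zero))) (Σℤ-indicator n (P ∘ suc))

record Partition {n} (P : Fin n → Bool) (c d : ℕ) : Set where
  field
    index   : (Fin c ⊎ Fin d) ↔ Fin n
    inside  : ∀ x → P (Inverse.to index (inj₁ x)) ≡ true
    outside : ∀ y → P (Inverse.to index (inj₂ y)) ≡ false

consˡ : ∀ {c d n} → (Fin c ⊎ Fin d) ↔ Fin n → (Fin (suc c) ⊎ Fin d) ↔ Fin (suc n)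
consˡ ι = ↔-trans (FP.+↔⊎ ⊎-↔ ↔-refl)
         (↔-trans (⊎-assoc 0ℓ _ _ _) (↔-trans (↔-refl ⊎-↔ ι) (↔-sym FP.+↔⊎)))

consʳ : ∀ {c d n} → (Fin c ⊎ Fin d) ↔ Fin n → (Fin c ⊎ Fin (suc d)) ↔ Fin (suc n)
consʳ ι = ↔-trans (⊎-comm _ _) (consˡ (↔-trans (⊎-comm _ _) ι))

partition : ∀ {n} (P : Fin n → Bool) → Partition P (count P) (count (not ∘ P))
partition {zero}  P = record
  { index = mk↔ₛ′ (λ { (inj₁ ()) ; (inj₂ ()) }) (λ ()) (λ ()) (λ { (inj₁ ()) ; (inj₂ ()) })
  ; inside = λ () ; outside = λ () }
partition {suc n} P with P zero in P₀ | partition (P ∘ suc)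
... | true  | p = record
  { index = consˡ (Partition.index p)
  ; inside = λ { zero → P₀ ; (suc x) → Partition.inside p x }
  ; outside = Partition.outside p }
... | false | p = record
  { index = consʳ (Partition.index p)
  ; inside = Partition.inside p
  ; outside = λ { zero → P₀ ; (suc y) → Partition.outside p y } }

partition-of-size : ∀ {n c d} (P : Fin n → Bool) → count P ≡ c → c ℕ.+ d ≡ n → Partition P c d
partition-of-size {c = c} {d} P #P≡c c+d≡n = subst₂ (Partition P) #P≡c #¬P≡d (partition P)
  where
  #¬P≡d : count (not ∘ P) ≡ d
  #¬P≡d = ℕP.+-cancelˡ-≡ c _ _
    (trans (cong (ℕ._+ count (not ∘ P)) (sym #P≡c)) (trans (count+count-not P) (sym c+d≡n)))

-- Signed permutations and H-equivalence

IsSign : ℤ → Set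
IsSign s = (s ≡ 1ℤ) ⊎ (s ≡ -1ℤ)

sign*sign≡1 : ∀ {s} → IsSign s → s * s ≡ 1ℤ
sign*sign≡1 (inj₁ refl) = refl
sign*sign≡1 (inj₂ refl) = refl

sign-* : ∀ {s t} → IsSign s → IsSign t → IsSign (s * t)
sign-* (inj₁ refl) (inj₁ refl) = inj₁ refl
sign-* (inj₁ refl) (inj₂ refl) = inj₂ refl
sign-* (inj₂ refl) (inj₁ refl) = inj₂ refl
sign-* (inj₂ refl) (inj₂ refl) = inj₁ refl

sign≢0 : ∀ {s} → IsSign s → s ≢ 0ℤ
sign≢0 (inj₁ refl) ()
sign≢0 (inj₂ refl) ()

record SignedPerm (m n : ℕ) : Set where
  field
    perm   : Permutation m n
    sign   : Fin m → ℤ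
    isSign : ∀ i → IsSign (sign i)

open SignedPerm

unsigned : ∀ {m n} → Permutation m n → SignedPerm m n
unsigned π = record { perm = π ; sign = λ _ → 1ℤ ; isSign = λ _ → inj₁ refl }

idₛ : ∀ {n} → SignedPerm n n
idₛ = unsigned Perm.id

_⁻¹ₛ : ∀ {m n} → SignedPerm m n → SignedPerm n m
σ ⁻¹ₛ = record
  { perm   = Perm.flip (perm σ)
  ; sign   = λ j → sign σ (perm σ ⟨$⟩ˡ j)
  ; isSign = λ j → isSign σ (perm σ ⟨$⟩ˡ j)
  }

_∘ₛ_ : ∀ {m n o} → SignedPerm m n → SignedPerm n o → SignedPerm m o
σ ∘ₛ τ = record
  { perm   = perm σ Perm.∘ₚ perm τ
  ; sign   = λ i → sign σ i * sign τ (perm σ ⟨$⟩ʳ i)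
  ; isSign = λ i → sign-* (isSign σ i) (isSign τ (perm σ ⟨$⟩ʳ i))
  }

_⊕ₛ_ : ∀ {m n m′ n′} → SignedPerm m m′ → SignedPerm n n′ → SignedPerm (m ℕ.+ n) (m′ ℕ.+ n′)
_⊕ₛ_ {m} σ τ = record
  { perm   = ↔-trans FP.+↔⊎ (↔-trans (perm σ ⊎-↔ perm τ) (↔-sym FP.+↔⊎))
  ; sign   = [ sign σ , sign τ ] ∘ splitAt m
  ; isSign = [_,_] {C = IsSign ∘ [ sign σ , sign τ ]} (isSign σ) (isSign τ) ∘ splitAt m
  }

transform : ∀ {m n} → SignedPerm m n → SignedPerm m n → Mat n n → Mat m m
transform σ τ A i j = sign σ i * (sign τ j * A (perm σ ⟨$⟩ʳ i) (perm τ ⟨$⟩ʳ j))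

transform-cong : ∀ {m n} (σ τ : SignedPerm m n) {A A′ : Mat n n} →
                 A ≋ A′ → transform σ τ A ≋ transform σ τ A′
transform-cong σ τ A≋A′ i j = cong (λ x → sign σ i * (sign τ j * x)) (A≋A′ _ _)

transform-zero : ∀ {m n} (σ τ : SignedPerm m n) (A : Mat n n) i j →
                 A (perm σ ⟨$⟩ʳ i) (perm τ ⟨$⟩ʳ j) ≡ 0ℤ → transform σ τ A i j ≡ 0ℤ
transform-zero σ τ A i j a≡0 =
  trans (cong (λ x → sign σ i * (sign τ j * x)) a≡0) (*-zeroʳ₂ (sign σ i) (sign τ j))

transform-unsigned : ∀ {m n} (π π′ : Permutation m n) (A : Mat n n) i j →
                     transform (unsigned π) (unsigned π′) A i j ≡ A (π ⟨$⟩ʳ i) (π′ ⟨$⟩ʳ j)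
transform-unsigned π π′ A i j = trans (ℤP.*-identityˡ _) (ℤP.*-identityˡ _)

transform-idₛ : ∀ {n} (A : Mat n n) → transform idₛ idₛ A ≋ A
transform-idₛ = transform-unsigned Perm.id Perm.id

transform-∘ₛ : ∀ {m n o} (σ τ : SignedPerm m n) (σ′ τ′ : SignedPerm n o) (A : Mat o o) →
               transform σ τ (transform σ′ τ′ A) ≋ transform (σ ∘ₛ σ′) (τ ∘ₛ τ′) A
transform-∘ₛ σ τ σ′ τ′ A i j = regroup (sign σ i) (sign τ j) _ _ _
  where
  regroup : ∀ s t s′ t′ x → s * (t * (s′ * (t′ * x))) ≡ (s * s′) * ((t * t′) * x)
  regroup = solve-∀

transform-⁻¹ₛ : ∀ {m n} (σ τ : SignedPerm m n) (A : Mat n n) →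
                transform (σ ⁻¹ₛ) (τ ⁻¹ₛ) (transform σ τ A) ≋ A
transform-⁻¹ₛ σ τ A p q = begin
  s * (t * (s * (t * A (perm σ ⟨$⟩ʳ (perm σ ⟨$⟩ˡ p)) (perm τ ⟨$⟩ʳ (perm τ ⟨$⟩ˡ q)))))
    ≡⟨ cong₂ (λ x y → s * (t * (s * (t * A x y)))) (Perm.inverseʳ (perm σ)) (Perm.inverseʳ (perm τ)) ⟩
  s * (t * (s * (t * A p q)))  ≡⟨ regroup s t (A p q) ⟩
  (s * s) * ((t * t) * A p q)
    ≡⟨ cong₂ (λ x y → x * (y * A p q)) (sign*sign≡1 (isSign σ _)) (sign*sign≡1 (isSign τ _)) ⟩
  1ℤ * (1ℤ * A p q)            ≡⟨ transform-idₛ A p q ⟩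
  A p q                        ∎
  where
  open ≡-Reasoning
  s = sign σ (perm σ ⟨$⟩ˡ p)
  t = sign τ (perm τ ⟨$⟩ˡ q)
  regroup : ∀ s t x → s * (t * (s * (t * x))) ≡ (s * s) * ((t * t) * x)
  regroup = solve-∀

-- A proof-relevant form of _∼H′_, see ∼H′⇒≃H and ≃H⇒∼H′.
record _≃H_ {n m} (A : Mat n n) (B : Mat m m) : Set where
  field
    rows cols  : SignedPerm m n
    transforms : B ≋ transform rows cols A

open _≃H_

≃H-refl : ∀ {n} {A : Mat n n} → A ≃H A
≃H-refl {A = A} = record { rows = idₛ ; cols = idₛ ; transforms = λ i j → sym (transform-idₛ A i j) }

≃H-sym : ∀ {n m} {A : Mat n n} {B : Mat m m} → A ≃H B → B ≃H A
≃H-sym {A = A} {B} E = record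
  { rows = rows E ⁻¹ₛ ; cols = cols E ⁻¹ₛ
  ; transforms = λ i j → sym (trans (transform-cong (rows E ⁻¹ₛ) (cols E ⁻¹ₛ) (transforms E) i j)
                                    (transform-⁻¹ₛ (rows E) (cols E) A i j))
  }

≃H-trans : ∀ {n m p} {A : Mat n n} {B : Mat m m} {C : Mat p p} → A ≃H B → B ≃H C → A ≃H C
≃H-trans {A = A} E F = record
  { rows = rows F ∘ₛ rows E ; cols = cols F ∘ₛ cols E
  ; transforms = λ i j → trans (transforms F i j)
      (trans (transform-cong (rows F) (cols F) (transforms E) i j)
             (transform-∘ₛ (rows F) (cols F) (rows E) (cols E) A i j))
  }

monomial : ∀ {n} → SignedPerm n n → Mat n n
monomial σ i j with perm σ ⟨$⟩ʳ i F.≟ j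
... | yes _ = sign σ i
... | no  _ = 0ℤ

monomial-on : ∀ {n} (σ : SignedPerm n n) i → monomial σ i (perm σ ⟨$⟩ʳ i) ≡ sign σ i
monomial-on σ i with perm σ ⟨$⟩ʳ i F.≟ perm σ ⟨$⟩ʳ i
... | yes _ = refl
... | no ≢ = ⊥-elim (≢ refl)

monomial-off : ∀ {n} (σ : SignedPerm n n) i j → j ≢ perm σ ⟨$⟩ʳ i → monomial σ i j ≡ 0ℤ
monomial-off σ i j j≢ with perm σ ⟨$⟩ʳ i F.≟ j
... | yes ≡j = ⊥-elim (j≢ (sym ≡j))
... | no  _  = refl

monomial-isMonomial : ∀ {n} (σ : SignedPerm n n) → IsMonomial (monomial σ)
monomial-isMonomial {n} σ = entries , row , column
  where
  π = perm σ
  nonzero⇒on : ∀ i j → monomial σ i j ≢ 0ℤ → j ≡ π ⟨$⟩ʳ i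
  nonzero⇒on i j ≢0 with j FP.≟ π ⟨$⟩ʳ i
  ... | yes j≡ = j≡
  ... | no  j≢ = ⊥-elim (≢0 (monomial-off σ i j j≢))
  entries : ∀ i j → (monomial σ i j ≡ 0ℤ) ⊎ ((monomial σ i j ≡ 1ℤ) ⊎ (monomial σ i j ≡ -1ℤ))
  entries i j with perm σ ⟨$⟩ʳ i F.≟ j
  ... | yes _ = inj₂ (isSign σ i)
  ... | no  _ = inj₁ refl
  on≢0 : ∀ i → monomial σ i (π ⟨$⟩ʳ i) ≢ 0ℤ
  on≢0 i = subst (_≢ 0ℤ) (sym (monomial-on σ i)) (sign≢0 (isSign σ i))
  row : ∀ i → Σ (Fin n) λ j → (monomial σ i j ≢ 0ℤ) × (∀ j′ → monomial σ i j′ ≢ 0ℤ → j′ ≡ j)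
  row i = π ⟨$⟩ʳ i , on≢0 i , nonzero⇒on i
  column : ∀ j → Σ (Fin n) λ i → (monomial σ i j ≢ 0ℤ) × (∀ i′ → monomial σ i′ j ≢ 0ℤ → i′ ≡ i)
  column j = π ⟨$⟩ˡ j
           , subst (λ j′ → monomial σ (π ⟨$⟩ˡ j) j′ ≢ 0ℤ) (Perm.inverseʳ π) (on≢0 (π ⟨$⟩ˡ j))
           , λ i′ ≢0 → trans (sym (Perm.inverseˡ π)) (cong (π ⟨$⟩ˡ_) (sym (nonzero⇒on i′ j ≢0)))

monomial-·ˡ : ∀ {n p} (σ : SignedPerm n n) (X : Mat n p) i j →
              (monomial σ · X) i j ≡ sign σ i * X (perm σ ⟨$⟩ʳ i) j
monomial-·ˡ {n} σ X i j = trans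
  (Σℤ-single n _ (perm σ ⟨$⟩ʳ i) (λ l l≢ → cong (_* X l j) (monomial-off σ i l l≢)))
  (cong (_* X (perm σ ⟨$⟩ʳ i) j) (monomial-on σ i))

monomial-·ʳ : ∀ {n p} (σ : SignedPerm n n) (X : Mat p n) i j →
              (X · (monomial σ ᵀ)) i j ≡ X i (perm σ ⟨$⟩ʳ j) * sign σ j
monomial-·ʳ {n} σ X i j = trans
  (Σℤ-single n _ (perm σ ⟨$⟩ʳ j)
     (λ l l≢ → trans (cong (X i l *_) (monomial-off σ j l l≢)) (ℤP.*-zeroʳ (X i l))))
  (cong (X i (perm σ ⟨$⟩ʳ j) *_) (monomial-on σ j))

isMonomial⇒monomial : ∀ {n} {M : Mat n n} → IsMonomial M → Σ (SignedPerm n n) λ σ → M ≋ monomial σ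
isMonomial⇒monomial {n} {M} (entries , row , column) = σ , M≋
  where
  colOf : Fin n → Fin n
  colOf i = proj₁ (row i)
  rowOf : Fin n → Fin n
  rowOf j = proj₁ (column j)
  on≢0 : ∀ i → M i (colOf i) ≢ 0ℤ
  on≢0 i = proj₁ (proj₂ (row i))
  isSign-on : ∀ i → IsSign (M i (colOf i))
  isSign-on i with entries i (colOf i)
  ... | inj₁ ≡0 = ⊥-elim (on≢0 i ≡0)
  ... | inj₂ ±1 = ±1
  σ : SignedPerm n n
  σ = record
    { perm   = permutation colOf rowOf
        (λ j → sym (proj₂ (proj₂ (row (rowOf j))) j (proj₁ (proj₂ (column j)))))
        (λ i → sym (proj₂ (proj₂ (column (colOf i))) i (on≢0 i)))
    ; sign   = λ i → M i (colOf i)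
    ; isSign = isSign-on
    }
  M≋ : M ≋ monomial σ
  M≋ i j with j FP.≟ colOf i
  ... | yes refl = sym (monomial-on σ i)
  ... | no  j≢ with M i j ℤ.≟ 0ℤ
  ...   | yes ≡0 = trans ≡0 (sym (monomial-off σ i j j≢))
  ...   | no  ≢0 = ⊥-elim (j≢ (proj₂ (proj₂ (row i)) j ≢0))

·-cong : ∀ {m n p} {A A′ : Mat m n} {B B′ : Mat n p} → A ≋ A′ → B ≋ B′ → (A · B) ≋ (A′ · B′)
·-cong {n = n} A≋A′ B≋B′ i j = Σℤ-cong n (λ l → cong₂ _*_ (A≋A′ i l) (B≋B′ l j))

monomial-transform : ∀ {n} (σ τ : SignedPerm n n) (A : Mat n n) →
                     ((monomial σ · A) · (monomial τ ᵀ)) ≋ transform σ τ A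
monomial-transform σ τ A i j = begin
  ((monomial σ · A) · (monomial τ ᵀ)) i j   ≡⟨ monomial-·ʳ τ (monomial σ · A) i j ⟩
  (monomial σ · A) i (perm τ ⟨$⟩ʳ j) * t    ≡⟨ cong (_* t) (monomial-·ˡ σ A i (perm τ ⟨$⟩ʳ j)) ⟩
  (s * a) * t                               ≡⟨ ℤP.*-assoc s a t ⟩
  s * (a * t)                               ≡⟨ cong (s *_) (ℤP.*-comm a t) ⟩
  s * (t * a)                               ∎
  where
  open ≡-Reasoning
  s = sign σ i
  t = sign τ j
  a = A (perm σ ⟨$⟩ʳ i) (perm τ ⟨$⟩ʳ j)

∼H′⇒≃H : ∀ {n m} {A : Mat n n} {B : Mat m m} → A ∼H′ B → A ≃H B
∼H′⇒≃H {A = A} {B} (refl , L , R , L-mono , R-mono , B≋LARᵀ)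
  with isMonomial⇒monomial L-mono | isMonomial⇒monomial R-mono
... | σ , L≋σ | τ , R≋τ = record { rows = σ ; cols = τ ; transforms = λ i j → begin
  B i j                                    ≡⟨ sym (cong₂ B (FP.cast-is-id refl i) (FP.cast-is-id refl j)) ⟩
  B (cast refl i) (cast refl j)            ≡⟨ B≋LARᵀ i j ⟩
  ((L · A) · (R ᵀ)) i j                    ≡⟨ ·-cong (·-cong L≋σ (λ _ _ → refl)) (λ l j → R≋τ j l) i j ⟩
  ((monomial σ · A) · (monomial τ ᵀ)) i j  ≡⟨ monomial-transform σ τ A i j ⟩
  transform σ τ A i j                      ∎ }
  where open ≡-Reasoning

≃H⇒∼H′ : ∀ {n m} {A : Mat n n} {B : Mat m m} → A ≃H B → A ∼H′ B
≃H⇒∼H′ {n} {A = A} E = go (Perm.↔⇒≡ (perm (rows E))) E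
  where
  go : ∀ {m} {B : Mat m m} → m ≡ n → A ≃H B → A ∼H′ B
  go {B = B} refl E = refl , monomial (rows E) , monomial (cols E)
     , monomial-isMonomial (rows E) , monomial-isMonomial (cols E)
     , λ i j → trans (cong₂ B (FP.cast-is-id refl i) (FP.cast-is-id refl j))
                     (trans (transforms E i j) (sym (monomial-transform (rows E) (cols E) A i j)))

≃H-nonzero : ∀ {n m} {A : Mat n n} {B : Mat m m} (E : A ≃H B) i j →
             B i j ≢ 0ℤ → A (perm (rows E) ⟨$⟩ʳ i) (perm (cols E) ⟨$⟩ʳ j) ≢ 0ℤ
≃H-nonzero {A = A} E i j Bij≢0 a≡0 =
  Bij≢0 (trans (transforms E i j) (transform-zero (rows E) (cols E) A i j a≡0))

≃H-zero-row : ∀ {n m} {A : Mat n n} {B : Mat m m} (E : A ≃H B) x →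
              (∀ y → B x y ≡ 0ℤ) → ∀ q → A (perm (rows E) ⟨$⟩ʳ x) q ≡ 0ℤ
≃H-zero-row {A = A} {B} E x row≡0 q = begin
  A (ρ ⟨$⟩ʳ x) q                                           ≡⟨ transforms (≃H-sym E) (ρ ⟨$⟩ʳ x) q ⟩
  s * (t * B (ρ ⟨$⟩ˡ (ρ ⟨$⟩ʳ x)) (perm (cols E) ⟨$⟩ˡ q))  ≡⟨ cong (λ p → s * (t * B p _)) (Perm.inverseˡ ρ) ⟩
  s * (t * B x (perm (cols E) ⟨$⟩ˡ q))                     ≡⟨ cong (λ b → s * (t * b)) (row≡0 _) ⟩
  s * (t * 0ℤ)                                              ≡⟨ *-zeroʳ₂ s t ⟩
  0ℤ                                                        ∎
  where
  open ≡-Reasoning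
  ρ = perm (rows E)
  s = sign (rows (≃H-sym E)) (ρ ⟨$⟩ʳ x)
  t = sign (cols (≃H-sym E)) q

≃H-empty : (A B : Mat 0 0) → A ≃H B
≃H-empty A B = record { rows = idₛ ; cols = idₛ ; transforms = λ () }

IsZero : ∀ {m n} → Mat m n → Set
IsZero X = ∀ i j → X i j ≡ 0ℤ

zero-≃H : ∀ {n m} {X : Mat n n} {Y : Mat m m} → n ≡ 1 → m ≡ 1 → IsZero X → IsZero Y → X ≃H Y
zero-≃H {X = X} refl refl X≡0 Y≡0 = record
  { rows = idₛ ; cols = idₛ
  ; transforms = λ i j → trans (Y≡0 i j) (sym (trans (transform-idₛ X i j) (X≡0 i j))) }

-- Block diagonal sums

blockDiag : ∀ {m n} → Mat m m → Mat n n → (Fin m ⊎ Fin n) → (Fin m ⊎ Fin n) → ℤ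
blockDiag X Y (inj₁ a) (inj₁ b) = X a b
blockDiag X Y (inj₂ a) (inj₂ b) = Y a b
blockDiag X Y (inj₁ _) (inj₂ _) = 0ℤ
blockDiag X Y (inj₂ _) (inj₁ _) = 0ℤ

⊕-splitAt : ∀ {m n} (X : Mat m m) (Y : Mat n n) i j →
            (X ⊕ Y) i j ≡ blockDiag X Y (splitAt m i) (splitAt m j)
⊕-splitAt {m} X Y i j with splitAt m i | splitAt m j
... | inj₁ _ | inj₁ _ = refl
... | inj₂ _ | inj₂ _ = refl
... | inj₁ _ | inj₂ _ = refl
... | inj₂ _ | inj₁ _ = refl

⊕-join : ∀ {m n} (X : Mat m m) (Y : Mat n n) u v →
         (X ⊕ Y) (join m n u) (join m n v) ≡ blockDiag X Y u v
⊕-join {m} {n} X Y u v =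
  trans (⊕-splitAt X Y _ _) (cong₂ (blockDiag X Y) (FP.splitAt-join m n u) (FP.splitAt-join m n v))

transform-⊕ₛ : ∀ {m n m′ n′} (σ τ : SignedPerm m m′) (σ′ τ′ : SignedPerm n n′)
               (X : Mat m′ m′) (Y : Mat n′ n′) →
               transform (σ ⊕ₛ σ′) (τ ⊕ₛ τ′) (X ⊕ Y) ≋ (transform σ τ X ⊕ transform σ′ τ′ Y)
transform-⊕ₛ {m} σ τ σ′ τ′ X Y i j = begin
  transform (σ ⊕ₛ σ′) (τ ⊕ₛ τ′) (X ⊕ Y) i j
    ≡⟨ cong (λ x → sign (σ ⊕ₛ σ′) i * (sign (τ ⊕ₛ τ′) j * x)) (⊕-join X Y (ρ⊎ (splitAt m i)) (γ⊎ (splitAt m j))) ⟩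
  [ sign σ , sign σ′ ] (splitAt m i) * ([ sign τ , sign τ′ ] (splitAt m j) *
    blockDiag X Y (ρ⊎ (splitAt m i)) (γ⊎ (splitAt m j)))
    ≡⟨ blocks (splitAt m i) (splitAt m j) ⟩
  blockDiag (transform σ τ X) (transform σ′ τ′ Y) (splitAt m i) (splitAt m j)
    ≡⟨ sym (⊕-splitAt (transform σ τ X) (transform σ′ τ′ Y) i j) ⟩
  (transform σ τ X ⊕ transform σ′ τ′ Y) i j  ∎
  where
  open ≡-Reasoning
  ρ⊎ = ⊎.map (perm σ ⟨$⟩ʳ_) (perm σ′ ⟨$⟩ʳ_)
  γ⊎ = ⊎.map (perm τ ⟨$⟩ʳ_) (perm τ′ ⟨$⟩ʳ_)
  blocks : ∀ u v → [ sign σ , sign σ′ ] u * ([ sign τ , sign τ′ ] v * blockDiag X Y (ρ⊎ u) (γ⊎ v))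
                 ≡ blockDiag (transform σ τ X) (transform σ′ τ′ Y) u v
  blocks (inj₁ a) (inj₁ b) = refl
  blocks (inj₂ a) (inj₂ b) = refl
  blocks (inj₁ a) (inj₂ b) = *-zeroʳ₂ (sign σ a) (sign τ′ b)
  blocks (inj₂ a) (inj₁ b) = *-zeroʳ₂ (sign σ′ a) (sign τ b)

⊕-≋ : ∀ {m n} {X X′ : Mat m m} {Y Y′ : Mat n n} → X ≋ X′ → Y ≋ Y′ → (X ⊕ Y) ≋ (X′ ⊕ Y′)
⊕-≋ {m} X≋X′ Y≋Y′ i j with splitAt m i | splitAt m j
... | inj₁ a | inj₁ b = X≋X′ a b
... | inj₂ a | inj₂ b = Y≋Y′ a b
... | inj₁ _ | inj₂ _ = refl
... | inj₂ _ | inj₁ _ = refl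

⊕-cong : ∀ {m n m′ n′} {X : Mat m m} {Y : Mat n n} {X′ : Mat m′ m′} {Y′ : Mat n′ n′} →
         X ≃H X′ → Y ≃H Y′ → (X ⊕ Y) ≃H (X′ ⊕ Y′)
⊕-cong {X = X} {Y} E F = record
  { rows = rows E ⊕ₛ rows F ; cols = cols E ⊕ₛ cols F
  ; transforms = λ i j → trans (⊕-≋ (transforms E) (transforms F) i j)
                               (sym (transform-⊕ₛ (rows E) (cols E) (rows F) (cols F) X Y i j))
  }

⊕-emptyʳ : ∀ {n} (Y : Mat n n) (Z : Mat 0 0) → Y ≃H (Y ⊕ Z)
⊕-emptyʳ {n} Y Z = record { rows = drop0 ; cols = drop0 ; transforms = Y⊕Z≋ }
  where
  drop0 : SignedPerm (n ℕ.+ 0) n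
  drop0 = unsigned (↔-trans FP.+↔⊎ (mk↔ₛ′ [ (λ a → a) , (λ ()) ] inj₁ (λ _ → refl) [ (λ _ → refl) , (λ ()) ]))
  Y⊕Z≋ : (Y ⊕ Z) ≋ transform drop0 drop0 Y
  Y⊕Z≋ i j with splitAt n i | splitAt n j
  ... | inj₁ a | inj₁ b = sym (transform-idₛ Y a b)
  ... | inj₂ () | _
  ... | inj₁ _ | inj₂ ()

embed : ∀ r (bs : Fin r → Block) a → Fin (size (bs a)) → Fin (totalSize r bs)
embed (suc r) bs zero    i = i ↑ˡ totalSize r (bs ∘ suc)
embed (suc r) bs (suc a) i = size (bs zero) ↑ʳ embed r (bs ∘ suc) a i

Located : ∀ r (bs : Fin r → Block) → Fin (totalSize r bs) → Set
Located r bs x = Σ (Fin r) λ a → Σ (Fin (size (bs a))) λ i → embed r bs a i ≡ x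

locate : ∀ r (bs : Fin r → Block) x → Located r bs x
locate (suc r) bs x = from-splitAt (splitAt m x) (FP.join-splitAt m _ x)
  where
  m = size (bs zero)
  from-splitAt : ∀ u → join m (totalSize r (bs ∘ suc)) u ≡ x → Located (suc r) bs x
  from-splitAt (inj₁ i) e = zero , i , e
  from-splitAt (inj₂ y) e with locate r (bs ∘ suc) y
  ... | a , i , e′ = suc a , i , trans (cong (m ↑ʳ_) e′) e

blockOf : ∀ r (bs : Fin r → Block) → Fin (totalSize r bs) → Fin r
blockOf r bs x = proj₁ (locate r bs x)

blockOf⇒embed : ∀ r (bs : Fin r → Block) x a → blockOf r bs x ≡ a →
                Σ (Fin (size (bs a))) λ i → embed r bs a i ≡ x
blockOf⇒embed r bs x a e with locate r bs x
... | a′ , i , e′ = subst (λ b → Σ (Fin (size (bs b))) λ i → embed r bs b i ≡ x) e (i , e′)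

↑ˡ≢↑ʳ : ∀ m n (i : Fin m) (j : Fin n) → i ↑ˡ n ≢ m ↑ʳ j
↑ˡ≢↑ʳ m n i j e with trans (sym (FP.splitAt-↑ˡ m i n)) (trans (cong (splitAt m) e) (FP.splitAt-↑ʳ m n j))
... | ()

embed-injectiveˡ : ∀ r (bs : Fin r → Block) a b i j → embed r bs a i ≡ embed r bs b j → a ≡ b
embed-injectiveˡ (suc r) bs zero    zero    i j e = refl
embed-injectiveˡ (suc r) bs zero    (suc b) i j e = ⊥-elim (↑ˡ≢↑ʳ _ _ i _ e)
embed-injectiveˡ (suc r) bs (suc a) zero    i j e = ⊥-elim (↑ˡ≢↑ʳ _ _ j _ (sym e))
embed-injectiveˡ (suc r) bs (suc a) (suc b) i j e =
  cong suc (embed-injectiveˡ r (bs ∘ suc) a b i j (FP.↑ʳ-injective (size (bs zero)) _ _ e))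

embed-injectiveʳ : ∀ r (bs : Fin r → Block) a i j → embed r bs a i ≡ embed r bs a j → i ≡ j
embed-injectiveʳ (suc r) bs zero    i j e = FP.↑ˡ-injective _ i j e
embed-injectiveʳ (suc r) bs (suc a) i j e =
  embed-injectiveʳ r (bs ∘ suc) a i j (FP.↑ʳ-injective (size (bs zero)) _ _ e)

blockOf-embed : ∀ r (bs : Fin r → Block) a i → blockOf r bs (embed r bs a i) ≡ a
blockOf-embed r bs a i with locate r bs (embed r bs a i)
... | a′ , i′ , e = embed-injectiveˡ r bs a′ a i′ i e

⨁-embed : ∀ r (bs : Fin r → Block) a i j → ⨁ r bs (embed r bs a i) (embed r bs a j) ≡ mat (bs a) i j
⨁-embed (suc r) bs zero    i j = ⊕-join (mat (bs zero)) (⨁ r (bs ∘ suc)) (inj₁ i) (inj₁ j)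
⨁-embed (suc r) bs (suc a) i j =
  trans (⊕-join (mat (bs zero)) (⨁ r (bs ∘ suc)) (inj₂ _) (inj₂ _)) (⨁-embed r (bs ∘ suc) a i j)

⨁-embed-≢ : ∀ r (bs : Fin r → Block) a b i j → a ≢ b → ⨁ r bs (embed r bs a i) (embed r bs b j) ≡ 0ℤ
⨁-embed-≢ (suc r) bs zero    zero    i j a≢b = ⊥-elim (a≢b refl)
⨁-embed-≢ (suc r) bs zero    (suc b) i j a≢b = ⊕-join (mat (bs zero)) (⨁ r (bs ∘ suc)) (inj₁ i) (inj₂ _)
⨁-embed-≢ (suc r) bs (suc a) zero    i j a≢b = ⊕-join (mat (bs zero)) (⨁ r (bs ∘ suc)) (inj₂ _) (inj₁ j)
⨁-embed-≢ (suc r) bs (suc a) (suc b) i j a≢b =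
  trans (⊕-join (mat (bs zero)) (⨁ r (bs ∘ suc)) (inj₂ _) (inj₂ _))
        (⨁-embed-≢ r (bs ∘ suc) a b i j (a≢b ∘ cong suc))

⨁-nonzero⇒blockOf≡ : ∀ r (bs : Fin r → Block) x y → ⨁ r bs x y ≢ 0ℤ → blockOf r bs x ≡ blockOf r bs y
⨁-nonzero⇒blockOf≡ r bs x y ≢0 with locate r bs x | locate r bs y
... | a , i , refl | b , j , refl with a F.≟ b
...   | yes a≡b = a≡b
...   | no  a≢b = ⊥-elim (≢0 (⨁-embed-≢ r bs a b i j a≢b))

⨁-zero-row : ∀ r (bs : Fin r → Block) a → IsZero (mat (bs a)) → ∀ i y → ⨁ r bs (embed r bs a i) y ≡ 0ℤ
⨁-zero-row r bs a block≡0 i y with locate r bs y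
... | b , j , refl with a F.≟ b
...   | yes refl = trans (⨁-embed r bs a i j) (block≡0 i j)
...   | no  a≢b  = ⨁-embed-≢ r bs a b i j a≢b

-- Weighing matrices

scalarI-diag : ∀ {n} k (i : Fin n) → scalarI k i i ≡ k
scalarI-diag k i with i F.≟ i
... | yes _ = refl
... | no i≢i = ⊥-elim (i≢i refl)

scalarI-offdiag : ∀ {n} k {i j : Fin n} → i ≢ j → scalarI k i j ≡ 0ℤ
scalarI-offdiag k {i} {j} i≢j with i F.≟ j
... | yes i≡j = ⊥-elim (i≢j i≡j)
... | no  _   = refl

scalarI-injective : ∀ {m n} k (f : Fin m → Fin n) → (∀ {i j} → f i ≡ f j → i ≡ j) →
                    ∀ i j → scalarI k (f i) (f j) ≡ scalarI k i j
scalarI-injective k f f-inj i j with i F.≟ j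
... | yes refl = scalarI-diag k (f i)
... | no  i≢j  = scalarI-offdiag k (i≢j ∘ f-inj)

transform-·ᵀ : ∀ {m n} (σ τ : SignedPerm m n) (A : Mat n n) →
               (transform σ τ A · (transform σ τ A ᵀ)) ≋ transform σ σ (A · (A ᵀ))
transform-·ᵀ {m} {n} σ τ A i i′ = begin
  Σℤ m (λ l → transform σ τ A i l * transform σ τ A i′ l)
    ≡⟨ Σℤ-cong m (λ l → cancel-τ (sign τ l) (a (γ l)) (a′ (γ l)) (sign*sign≡1 (isSign τ l))) ⟩
  Σℤ m (λ l → s * (s′ * (a (γ l) * a′ (γ l))))
    ≡⟨ sym (trans (cong (s *_) (*-distribˡ-Σℤ m s′ _)) (*-distribˡ-Σℤ m s _)) ⟩
  s * (s′ * Σℤ m (λ l → a (γ l) * a′ (γ l)))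
    ≡⟨ cong (λ x → s * (s′ * x)) (sym (Σℤ-permute (perm τ) (λ q → a q * a′ q))) ⟩
  s * (s′ * Σℤ n (λ q → a q * a′ q))  ∎
  where
  open ≡-Reasoning
  γ  = perm τ ⟨$⟩ʳ_
  s  = sign σ i
  s′ = sign σ i′
  a  = A (perm σ ⟨$⟩ʳ i)
  a′ = A (perm σ ⟨$⟩ʳ i′)
  cancel-τ : ∀ t x x′ → t * t ≡ 1ℤ → (s * (t * x)) * (s′ * (t * x′)) ≡ s * (s′ * (x * x′))
  cancel-τ t x x′ t²≡1 = begin
    (s * (t * x)) * (s′ * (t * x′))  ≡⟨ reassoc s s′ t x x′ ⟩
    s * (s′ * ((t * t) * (x * x′)))  ≡⟨ cong (λ u → s * (s′ * (u * (x * x′)))) t²≡1 ⟩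
    s * (s′ * (1ℤ * (x * x′)))       ≡⟨ cong (λ u → s * (s′ * u)) (ℤP.*-identityˡ (x * x′)) ⟩
    s * (s′ * (x * x′))              ∎
    where
    reassoc : ∀ s s′ t x x′ → (s * (t * x)) * (s′ * (t * x′)) ≡ s * (s′ * ((t * t) * (x * x′)))
    reassoc = solve-∀

transform-scalarI : ∀ {m n} (σ : SignedPerm m n) k → transform σ σ (scalarI k) ≋ scalarI k
transform-scalarI σ k i i′ with i F.≟ i′
... | yes refl = begin
  s * (s * scalarI k (ρ i) (ρ i))  ≡⟨ cong (λ x → s * (s * x)) (scalarI-diag k (ρ i)) ⟩
  s * (s * k)                      ≡⟨ sym (ℤP.*-assoc s s k) ⟩
  (s * s) * k                      ≡⟨ cong (_* k) (sign*sign≡1 (isSign σ i)) ⟩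
  1ℤ * k                           ≡⟨ ℤP.*-identityˡ k ⟩
  k                                ∎
  where
  open ≡-Reasoning
  ρ = perm σ ⟨$⟩ʳ_
  s = sign σ i
... | no i≢i′ = trans
  (cong (λ x → sign σ i * (sign σ i′ * x)) (scalarI-offdiag k (i≢i′ ∘ Injection.injective (↔⇒↣ (perm σ)))))
  (*-zeroʳ₂ (sign σ i) (sign σ i′))

isWeighing-≃H : ∀ {n m} {A : Mat n n} {B : Mat m m} → A ≃H B → IsWeighing A → IsWeighing B
isWeighing-≃H {A = A} {B} E (k , AAᵀ≋kI) = k , λ i i′ → begin
  (B · (B ᵀ)) i i′                              ≡⟨ ·-cong (transforms E) (λ l j → transforms E j l) i i′ ⟩
  (transform σ τ A · (transform σ τ A ᵀ)) i i′   ≡⟨ transform-·ᵀ σ τ A i i′ ⟩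
  transform σ σ (A · (A ᵀ)) i i′                 ≡⟨ transform-cong σ σ AAᵀ≋kI i i′ ⟩
  transform σ σ (scalarI k) i i′                 ≡⟨ transform-scalarI σ k i i′ ⟩
  scalarI k i i′                                 ∎
  where
  open ≡-Reasoning
  σ = rows E
  τ = cols E

⊕-·ᵀ-↑ˡ : ∀ {m n} (X : Mat m m) (Y : Mat n n) a b →
          ((X ⊕ Y) · ((X ⊕ Y) ᵀ)) (a ↑ˡ n) (b ↑ˡ n) ≡ (X · (X ᵀ)) a b
⊕-·ᵀ-↑ˡ {m} {n} X Y a b = begin
  Σℤ (m ℕ.+ n) (λ l → X⊕Y (a ↑ˡ n) l * X⊕Y (b ↑ˡ n) l)  ≡⟨ Σℤ-splitAt m n _ ⟩
  Σℤ m (λ l → X⊕Y (a ↑ˡ n) (l ↑ˡ n) * X⊕Y (b ↑ˡ n) (l ↑ˡ n))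
    + Σℤ n (λ l → X⊕Y (a ↑ˡ n) (m ↑ʳ l) * X⊕Y (b ↑ˡ n) (m ↑ʳ l))
    ≡⟨ cong₂ _+_ (Σℤ-cong m (λ l → cong₂ _*_ (⊕-join X Y (inj₁ a) (inj₁ l)) (⊕-join X Y (inj₁ b) (inj₁ l))))
                 (Σℤ-zero n (λ l → cong (_* X⊕Y (b ↑ˡ n) (m ↑ʳ l)) (⊕-join X Y (inj₁ a) (inj₂ l)))) ⟩
  (X · (X ᵀ)) a b + 0ℤ                                  ≡⟨ ℤP.+-identityʳ _ ⟩
  (X · (X ᵀ)) a b                                       ∎
  where
  open ≡-Reasoning
  X⊕Y = X ⊕ Y

⊕-·ᵀ-↑ʳ : ∀ {m n} (X : Mat m m) (Y : Mat n n) a b →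
          ((X ⊕ Y) · ((X ⊕ Y) ᵀ)) (m ↑ʳ a) (m ↑ʳ b) ≡ (Y · (Y ᵀ)) a b
⊕-·ᵀ-↑ʳ {m} {n} X Y a b = begin
  Σℤ (m ℕ.+ n) (λ l → X⊕Y (m ↑ʳ a) l * X⊕Y (m ↑ʳ b) l)  ≡⟨ Σℤ-splitAt m n _ ⟩
  Σℤ m (λ l → X⊕Y (m ↑ʳ a) (l ↑ˡ n) * X⊕Y (m ↑ʳ b) (l ↑ˡ n))
    + Σℤ n (λ l → X⊕Y (m ↑ʳ a) (m ↑ʳ l) * X⊕Y (m ↑ʳ b) (m ↑ʳ l))
    ≡⟨ cong₂ _+_ (Σℤ-zero m (λ l → cong (_* X⊕Y (m ↑ʳ b) (l ↑ˡ n)) (⊕-join X Y (inj₂ a) (inj₁ l))))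
                 (Σℤ-cong n (λ l → cong₂ _*_ (⊕-join X Y (inj₂ a) (inj₂ l)) (⊕-join X Y (inj₂ b) (inj₂ l)))) ⟩
  0ℤ + (Y · (Y ᵀ)) a b                                  ≡⟨ ℤP.+-identityˡ _ ⟩
  (Y · (Y ᵀ)) a b                                       ∎
  where
  open ≡-Reasoning
  X⊕Y = X ⊕ Y

isWeighing-⊕ : ∀ {m n} (X : Mat m m) (Y : Mat n n) → IsWeighing (X ⊕ Y) → IsWeighing X × IsWeighing Y
isWeighing-⊕ {m} {n} X Y (k , W) =
    (k , λ a b → trans (sym (⊕-·ᵀ-↑ˡ X Y a b))
                       (trans (W _ _) (scalarI-injective k (_↑ˡ n) (FP.↑ˡ-injective n _ _) a b)))
  , (k , λ a b → trans (sym (⊕-·ᵀ-↑ʳ X Y a b))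
                       (trans (W _ _) (scalarI-injective k (m ↑ʳ_) (FP.↑ʳ-injective m _ _) a b)))

gram-frobenius : ∀ {m n} (A : Mat m n) →
                 ΣΣ n (λ j l → ((A ᵀ) · A) j l * ((A ᵀ) · A) j l)
                   ≡ ΣΣ m (λ i i′ → (A · (A ᵀ)) i i′ * (A · (A ᵀ)) i i′)
gram-frobenius {m} {n} A = begin
  ΣΣ n (λ j l → Σℤ m (λ i → A i j * A i l) * Σℤ m (λ i′ → A i′ j * A i′ l))
    ≡⟨ ΣΣ-cong n (λ j l → Σℤ-*-Σℤ m m _ _) ⟩
  ΣΣ n (λ j l → ΣΣ m (λ i i′ → (A i j * A i l) * (A i′ j * A i′ l)))
    ≡⟨ ΣΣ-ΣΣ-comm m n _ ⟩
  ΣΣ m (λ i i′ → ΣΣ n (λ j l → (A i j * A i l) * (A i′ j * A i′ l)))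
    ≡⟨ ΣΣ-cong m (λ i i′ → ΣΣ-cong n (λ j l → interchange (A i j) (A i l) (A i′ j) (A i′ l))) ⟩
  ΣΣ m (λ i i′ → ΣΣ n (λ j l → (A i j * A i′ j) * (A i l * A i′ l)))
    ≡⟨ ΣΣ-cong m (λ i i′ → sym (Σℤ-*-Σℤ n n _ _)) ⟩
  ΣΣ m (λ i i′ → Σℤ n (λ j → A i j * A i′ j) * Σℤ n (λ l → A i l * A i′ l))  ∎
  where
  open ≡-Reasoning
  interchange : ∀ a b c d → (a * b) * (c * d) ≡ (a * c) * (b * d)
  interchange = solve-∀

gram-trace : ∀ {m n} (A : Mat m n) → Σℤ n (λ j → ((A ᵀ) · A) j j) ≡ Σℤ m (λ i → (A · (A ᵀ)) i i)
gram-trace {m} {n} A = Σℤ-comm n m (λ j i → A i j * A i j)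

ΣΣ-*-scalarI : ∀ n (M : Fin n → Fin n → ℤ) k →
               ΣΣ n (λ j l → M j l * scalarI k j l) ≡ Σℤ n (λ j → M j j) * k
ΣΣ-*-scalarI n M k = begin
  ΣΣ n (λ j l → M j l * scalarI k j l)
    ≡⟨ Σℤ-cong n (λ j → Σℤ-single n _ j (λ l l≢j →
         trans (cong (M j l *_) (scalarI-offdiag k (l≢j ∘ sym))) (ℤP.*-zeroʳ (M j l)))) ⟩
  Σℤ n (λ j → M j j * scalarI k j j)  ≡⟨ Σℤ-cong n (λ j → cong (M j j *_) (scalarI-diag k j)) ⟩
  Σℤ n (λ j → M j j * k)              ≡⟨ sym (*-distribʳ-Σℤ n k _) ⟩
  Σℤ n (λ j → M j j) * k              ∎
  where open ≡-Reasoning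

-- The entries of AᵀA − kI have vanishing sum of squares, because
-- ΣΣ (AᵀA)² = ΣΣ (AAᵀ)² and tr (AᵀA) = tr (AAᵀ).
weighing-ᵀ : ∀ {n} (A : Mat n n) k → (A · (A ᵀ)) ≋ scalarI k → ((A ᵀ) · A) ≋ scalarI k
weighing-ᵀ {n} A k AAᵀ≋D j l =
  ℤP.i-j≡0⇒i≡j _ _ (sq≡0⇒≡0 _ (Σℤ-nonneg-≡0 n _ (λ l → sq-nonneg (G j l - D j l)) row≡0 l))
  where
  G = (A ᵀ) · A
  D = scalarI k
  ΣΣDD = ΣΣ n (λ j l → D j l * D j l)
  ΣΣGG≡ΣΣDD : ΣΣ n (λ j l → G j l * G j l) ≡ ΣΣDD
  ΣΣGG≡ΣΣDD = trans (gram-frobenius A) (ΣΣ-cong n (λ i i′ → cong₂ _*_ (AAᵀ≋D i i′) (AAᵀ≋D i i′)))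
  ΣΣGD≡ΣΣDD : ΣΣ n (λ j l → G j l * D j l) ≡ ΣΣDD
  ΣΣGD≡ΣΣDD = begin
    ΣΣ n (λ j l → G j l * D j l)  ≡⟨ ΣΣ-*-scalarI n G k ⟩
    Σℤ n (λ j → G j j) * k        ≡⟨ cong (_* k) (gram-trace A) ⟩
    Σℤ n (λ i → (A · (A ᵀ)) i i) * k  ≡⟨ cong (_* k) (Σℤ-cong n (λ i → AAᵀ≋D i i)) ⟩
    Σℤ n (λ i → D i i) * k        ≡⟨ sym (ΣΣ-*-scalarI n D k) ⟩
    ΣΣDD                          ∎
    where open ≡-Reasoning
  ΣΣ[G-D]²≡0 : ΣΣ n (λ j l → (G j l - D j l) * (G j l - D j l)) ≡ 0ℤ
  ΣΣ[G-D]²≡0 = begin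
    ΣΣ n (λ j l → (G j l - D j l) * (G j l - D j l))
      ≡⟨ ΣΣ-cong n (λ j l → expand (G j l) (D j l)) ⟩
    ΣΣ n (λ j l → (G j l * G j l - G j l * D j l) - (G j l * D j l - D j l * D j l))
      ≡⟨ ΣΣ-distrib-- n _ _ ⟩
    ΣΣ n (λ j l → G j l * G j l - G j l * D j l) - ΣΣ n (λ j l → G j l * D j l - D j l * D j l)
      ≡⟨ cong₂ _-_ (ΣΣ-distrib-- n _ _) (ΣΣ-distrib-- n _ _) ⟩
    (ΣΣ n (λ j l → G j l * G j l) - ΣΣ n (λ j l → G j l * D j l))
      - (ΣΣ n (λ j l → G j l * D j l) - ΣΣDD)
      ≡⟨ cong₂ (λ x y → (x - y) - (y - ΣΣDD)) ΣΣGG≡ΣΣDD ΣΣGD≡ΣΣDD ⟩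
    (ΣΣDD - ΣΣDD) - (ΣΣDD - ΣΣDD)
      ≡⟨ cong (λ x → x - x) (ℤP.+-inverseʳ ΣΣDD) ⟩
    0ℤ  ∎
    where
    open ≡-Reasoning
    expand : ∀ g d → (g - d) * (g - d) ≡ (g * g - g * d) - (g * d - d * d)
    expand = solve-∀
  row≡0 : Σℤ n (λ l → (G j l - D j l) * (G j l - D j l)) ≡ 0ℤ
  row≡0 = Σℤ-nonneg-≡0 n _ (λ j → Σℤ-nonneg n _ (λ l → sq-nonneg (G j l - D j l))) ΣΣ[G-D]²≡0 j

weight0⇒zero : ∀ {n} {X : Mat n n} → (X · (X ᵀ)) ≋ scalarI 0ℤ → IsZero X
weight0⇒zero {n} {X} XXᵀ≋0 i j = sq≡0⇒≡0 (X i j)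
  (Σℤ-nonneg-≡0 n _ (λ l → sq-nonneg (X i l)) (trans (XXᵀ≋0 i i) (scalarI-diag 0ℤ i)) j)

weight≢0⇒row≢0 : ∀ {n k} {X : Mat n n} → k ≢ 0ℤ → (X · (X ᵀ)) ≋ scalarI k → ∀ i → ¬ (∀ j → X i j ≡ 0ℤ)
weight≢0⇒row≢0 {n} {k} {X} k≢0 XXᵀ≋kI i row≡0 = k≢0 (begin
  k                              ≡⟨ sym (scalarI-diag k i) ⟩
  scalarI k i i                  ≡⟨ sym (XXᵀ≋kI i i) ⟩
  Σℤ n (λ j → X i j * X i j)     ≡⟨ Σℤ-zero n (λ j → cong (_* X i j) (row≡0 j)) ⟩
  0ℤ                             ∎)
  where open ≡-Reasoning

-- Separations and primitivity

Separates : ∀ {n} → Mat n n → (Fin n → Bool) → (Fin n → Bool) → Set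
Separates A P Q = ∀ i j → A i j ≢ 0ℤ → P i ≡ Q j

separated-zero : ∀ {n} {A : Mat n n} {P Q} → Separates A P Q → ∀ {i j} → P i ≢ Q j → A i j ≡ 0ℤ
separated-zero {A = A} sep {i} {j} Pi≢Qj with A i j ℤ.≟ 0ℤ
... | yes ≡0 = ≡0
... | no  ≢0 = ⊥-elim (Pi≢Qj (sep i j ≢0))

⊕-separates : ∀ {m n} {X : Mat m m} {Y : Mat n n} {P Q P′ Q′} → Separates X P Q → Separates Y P′ Q′ →
              Separates (X ⊕ Y) ([ P , P′ ] ∘ splitAt m) ([ Q , Q′ ] ∘ splitAt m)
⊕-separates {m} {X = X} {Y} {P} {Q} {P′} {Q′} sepX sepY i j ≢0 =
  blocks (splitAt m i) (splitAt m j) (≢0 ∘ trans (⊕-splitAt X Y i j))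
  where
  blocks : ∀ u v → blockDiag X Y u v ≢ 0ℤ → [ P , P′ ] u ≡ [ Q , Q′ ] v
  blocks (inj₁ a) (inj₁ b) ≢0 = sepX a b ≢0
  blocks (inj₂ a) (inj₂ b) ≢0 = sepY a b ≢0
  blocks (inj₁ _) (inj₂ _) ≢0 = ⊥-elim (≢0 refl)
  blocks (inj₂ _) (inj₁ _) ≢0 = ⊥-elim (≢0 refl)

const-separates : ∀ {n} (A : Mat n n) b → Separates A (λ _ → b) (λ _ → b)
const-separates A b _ _ _ = refl

count-[,]-splitAt : ∀ m n (P : Fin m → Bool) (Q : Fin n → Bool) →
                    count ([ P , Q ] ∘ splitAt m) ≡ count P ℕ.+ count Q
count-[,]-splitAt m n P Q = trans (count-splitAt m n _) (cong₂ ℕ._+_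
  (count-cong (λ i → cong [ P , Q ] (FP.splitAt-↑ˡ m i n)))
  (count-cong (λ j → cong [ P , Q ] (FP.splitAt-↑ʳ m n j))))

-- Equivalent to splitting off a block of size c (separation⇒splitting), but decidable.
record Separation {n} (A : Mat n n) (c : ℕ) : Set where
  field
    rowPart colPart : Fin n → Bool
    separates       : Separates A rowPart colPart
    count-rowPart   : count rowPart ≡ c
    count-colPart   : count colPart ≡ c
    1≤c             : 1 ℕ.≤ c
    c<n             : c ℕ.< n

open Separation

separation-≃H : ∀ {n m c} {A : Mat n n} {B : Mat m m} → A ≃H B → Separation A c → Separation B c
separation-≃H {A = A} E S = record
  { rowPart       = rowPart S ∘ ρ
  ; colPart       = colPart S ∘ γ
  ; separates     = λ i j ≢0 → separates S _ _ (≃H-nonzero E i j ≢0)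
  ; count-rowPart = trans (sym (count-permute (perm (rows E)) (rowPart S))) (count-rowPart S)
  ; count-colPart = trans (sym (count-permute (perm (cols E)) (colPart S))) (count-colPart S)
  ; 1≤c           = 1≤c S
  ; c<n           = subst (_ ℕ.<_) (sym (Perm.↔⇒≡ (perm (rows E)))) (c<n S)
  }
  where
  ρ = perm (rows E) ⟨$⟩ʳ_
  γ = perm (cols E) ⟨$⟩ʳ_

separation-⊕ˡ : ∀ {m n c} (X : Mat m m) (Y : Mat n n) → Separation X c → Separation (X ⊕ Y) c
separation-⊕ˡ {m} {n} {c} X Y S = record
  { rowPart       = [ rowPart S , (λ _ → false) ] ∘ splitAt m
  ; colPart       = [ colPart S , (λ _ → false) ] ∘ splitAt m
  ; separates     = ⊕-separates (separates S) (const-separates Y false)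
  ; count-rowPart = trans (count-[,]-splitAt m n _ _)
                      (trans (cong₂ ℕ._+_ (count-rowPart S) (count-false n)) (ℕP.+-identityʳ c))
  ; count-colPart = trans (count-[,]-splitAt m n _ _)
                      (trans (cong₂ ℕ._+_ (count-colPart S) (count-false n)) (ℕP.+-identityʳ c))
  ; 1≤c           = 1≤c S
  ; c<n           = ℕP.<-≤-trans (c<n S) (ℕP.m≤m+n m n)
  }

separation-⊕ʳ : ∀ {m n c} (X : Mat m m) (Y : Mat n n) → Separation Y c → Separation (X ⊕ Y) c
separation-⊕ʳ {m} {n} X Y S = record
  { rowPart       = [ (λ _ → false) , rowPart S ] ∘ splitAt m
  ; colPart       = [ (λ _ → false) , colPart S ] ∘ splitAt m
  ; separates     = ⊕-separates (const-separates X false) (separates S)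
  ; count-rowPart = trans (count-[,]-splitAt m n _ _) (cong₂ ℕ._+_ (count-false m) (count-rowPart S))
  ; count-colPart = trans (count-[,]-splitAt m n _ _) (cong₂ ℕ._+_ (count-false m) (count-colPart S))
  ; 1≤c           = 1≤c S
  ; c<n           = ℕP.<-≤-trans (c<n S) (ℕP.m≤n+m n m)
  }

separation-⊕ : ∀ {m n} (X : Mat m m) (Y : Mat n n) → 1 ℕ.≤ m → 1 ℕ.≤ n → Separation (X ⊕ Y) m
separation-⊕ {m} {n} X Y 1≤m 1≤n = record
  { rowPart       = firstBlock
  ; colPart       = firstBlock
  ; separates     = ⊕-separates (const-separates X true) (const-separates Y false)
  ; count-rowPart = count-firstBlock
  ; count-colPart = count-firstBlock
  ; 1≤c           = 1≤m
  ; c<n           = subst (ℕ._≤ m ℕ.+ n) (ℕP.+-comm m 1) (ℕP.+-monoʳ-≤ m 1≤n)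
  }
  where
  firstBlock : Fin (m ℕ.+ n) → Bool
  firstBlock = [ (λ _ → true) , (λ _ → false) ] ∘ splitAt m
  count-firstBlock : count firstBlock ≡ m
  count-firstBlock = trans (count-[,]-splitAt m n _ _)
    (trans (cong₂ ℕ._+_ (count-true m) (count-false n)) (ℕP.+-identityʳ m))

⨁-separation : ∀ r (bs : Fin r → Block) → 1 ℕ.≤ totalSize r bs →
               (∀ a → size (bs a) ℕ.< totalSize r bs) → ∃ (Separation (⨁ r bs))
⨁-separation (suc r) bs 1≤total smaller with size (bs zero) ℕ.≟ 0
... | yes m≡0 = _ , separation-⊕ʳ (mat (bs zero)) (⨁ r (bs ∘ suc)) (proj₂ (⨁-separation r (bs ∘ suc)
                     (subst (1 ℕ.≤_) total≡T 1≤total)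
                     (λ a → subst (size (bs (suc a)) ℕ.<_) total≡T (smaller (suc a)))))
  where
  total≡T : totalSize (suc r) bs ≡ totalSize r (bs ∘ suc)
  total≡T = cong (ℕ._+ totalSize r (bs ∘ suc)) m≡0
... | no m≢0 = _ , separation-⊕ (mat (bs zero)) (⨁ r (bs ∘ suc)) (ℕP.n≢0⇒n>0 m≢0) 1≤T
  where
  m = size (bs zero)
  1≤T : 1 ℕ.≤ totalSize r (bs ∘ suc)
  1≤T = ℕP.+-cancelˡ-< m 0 _
          (subst (ℕ._< m ℕ.+ totalSize r (bs ∘ suc)) (sym (ℕP.+-identityʳ m)) (smaller zero))

record Splitting {n} (A : Mat n n) (c : ℕ) : Set where
  field
    d           : ℕ
    left        : Mat c c
    right       : Mat d d
    ≃left⊕right : A ≃H (left ⊕ right)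
    c+d≡n       : c ℕ.+ d ≡ n

separation⇒splitting : ∀ {n c} {A : Mat n n} → Separation A c → Splitting A c
separation⇒splitting {n} {c} {A} S = record
  { d = d ; left = left ; right = right
  ; ≃left⊕right = record
      { rows = unsigned byRows ; cols = unsigned byCols
      ; transforms = λ i j → trans (⊕-splitAt left right i j)
          (trans (blocks (splitAt c i) (splitAt c j)) (sym (transform-unsigned byRows byCols A i j)))
      }
  ; c+d≡n = c+d≡n
  }
  where
  d = count (not ∘ rowPart S)
  c+d≡n : c ℕ.+ d ≡ n
  c+d≡n = trans (cong (ℕ._+ d) (sym (count-rowPart S))) (count+count-not (rowPart S))
  P : Partition (rowPart S) c d
  P = partition-of-size (rowPart S) (count-rowPart S) c+d≡n
  Q : Partition (colPart S) c d
  Q = partition-of-size (colPart S) (count-colPart S) c+d≡n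
  byRows byCols : Permutation (c ℕ.+ d) n
  byRows = ↔-trans FP.+↔⊎ (Partition.index P)
  byCols = ↔-trans FP.+↔⊎ (Partition.index Q)
  ι = Inverse.to (Partition.index P)
  κ = Inverse.to (Partition.index Q)
  left : Mat c c
  left i j = A (ι (inj₁ i)) (κ (inj₁ j))
  right : Mat d d
  right i j = A (ι (inj₂ i)) (κ (inj₂ j))
  true≢false : ∀ {b b′} → b ≡ true → b′ ≡ false → b ≢ b′
  true≢false refl refl ()
  blocks : ∀ u v → blockDiag left right u v ≡ A (ι u) (κ v)
  blocks (inj₁ a) (inj₁ b) = refl
  blocks (inj₂ a) (inj₂ b) = refl
  blocks (inj₁ a) (inj₂ b) = sym (separated-zero (separates S)
    (true≢false (Partition.inside P a) (Partition.outside Q b)))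
  blocks (inj₂ a) (inj₁ b) = sym (separated-zero (separates S)
    (true≢false (Partition.inside Q b) (Partition.outside P a) ∘ sym))

separation⇒¬primitive : ∀ {n c} {A : Mat n n} → Separation A c → ¬ Primitive A
separation⇒¬primitive {n} {c} {A} S (_ , indecomposable) =
  indecomposable (2 , pair , s≤s (s≤s z≤n) , smaller , ≃H⇒∼H′ A≃⨁pair)
  where
  open Splitting (separation⇒splitting S)
  pair : Fin 2 → Block
  pair zero       = c , left
  pair (suc zero) = d , right
  smaller : ∀ a → size (pair a) ℕ.< n
  smaller zero       = c<n S
  smaller (suc zero) = subst (d ℕ.<_) c+d≡n (ℕP.+-monoˡ-≤ d (1≤c S))
  A≃⨁pair : A ≃H ⨁ 2 pair
  A≃⨁pair = ≃H-trans ≃left⊕right (⊕-cong ≃H-refl (⊕-emptyʳ right (⨁ 0 (λ i → pair (suc (suc i))))))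

¬separation⇒primitive : ∀ {n} {A : Mat n n} → 1 ℕ.≤ n → (∀ c → ¬ Separation A c) → Primitive A
¬separation⇒primitive {A = A} 1≤n unseparated = 1≤n , λ (r , bs , _ , smaller , A∼⨁) →
  let E = ∼H′⇒≃H A∼⨁
      n≡total = sym (Perm.↔⇒≡ (perm (rows E)))
      (c , S) = ⨁-separation r bs (subst (1 ℕ.≤_) n≡total 1≤n) (λ a → subst (_ ℕ.<_) n≡total (smaller a))
  in unseparated c (separation-≃H (≃H-sym E) S)

separation? : ∀ {n} (A : Mat n n) c → Dec (Separation A c)
separation? {n} A c with 1 ℕ.≤? c | c ℕ.<? n
... | no ¬1≤c | _        = no (¬1≤c ∘ 1≤c)
... | yes _   | no ¬c<n  = no (¬c<n ∘ c<n)
... | yes 1≤c | yes c<n  =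
  Dec.map′ fromSubsets toSubsets (anySubset? λ p → anySubset? λ q → parts? (lookup p) (lookup q))
  where
  Parts : (Fin n → Bool) → (Fin n → Bool) → Set
  Parts P Q = Separates A P Q × count P ≡ c × count Q ≡ c
  parts? : ∀ P Q → Dec (Parts P Q)
  parts? P Q = FP.all? (λ i → FP.all? (λ j → ¬? (A i j ℤ.≟ 0ℤ) →-dec (P i Bool.≟ Q j)))
               ×-dec (count P ℕ.≟ c) ×-dec (count Q ℕ.≟ c)
  fromSubsets : (∃ λ p → ∃ λ q → Parts (lookup p) (lookup q)) → Separation A c
  fromSubsets (p , q , sep , #p , #q) = record
    { rowPart = lookup p ; colPart = lookup q ; separates = sep
    ; count-rowPart = #p ; count-colPart = #q ; 1≤c = 1≤c ; c<n = c<n }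
  toSubsets : Separation A c → ∃ λ p → ∃ λ q → Parts (lookup p) (lookup q)
  toSubsets S = tabulate P , tabulate Q
    , (λ i j ≢0 → trans (lookup∘tabulate P i) (trans (separates S i j ≢0) (sym (lookup∘tabulate Q j))))
    , trans (count-cong (lookup∘tabulate P)) (count-rowPart S)
    , trans (count-cong (lookup∘tabulate Q)) (count-colPart S)
    where
    P = rowPart S
    Q = colPart S

separates⇒count≡ : ∀ {n k} {X : Mat n n} → k ≢ 0ℤ → (X · (X ᵀ)) ≋ scalarI k →
                   ∀ {P Q} → Separates X P Q → count P ≡ count Q
separates⇒count≡ {n} {k} {X} k≢0 XXᵀ≋kI {P} {Q} sep =
  ℤP.+-injective (ℤP.*-cancelʳ-≡ _ _ k {{ℤ.≢-nonZero k≢0}} (begin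
    + count P * k                                 ≡⟨ cong (_* k) (sym (Σℤ-indicator n P)) ⟩
    Σℤ n (λ i → [P] i) * k                        ≡⟨ *-distribʳ-Σℤ n k [P] ⟩
    Σℤ n (λ i → [P] i * k)                        ≡⟨ Σℤ-cong n (λ i → cong ([P] i *_) (sym (row-norm i))) ⟩
    Σℤ n (λ i → [P] i * Σℤ n (λ j → X i j * X i j))  ≡⟨ Σℤ-cong n (λ i → *-distribˡ-Σℤ n ([P] i) _) ⟩
    Σℤ n (λ i → Σℤ n (λ j → [P] i * (X i j * X i j)))  ≡⟨ Σℤ-cong n (λ i → Σℤ-cong n (λ j → on-support i j)) ⟩
    Σℤ n (λ i → Σℤ n (λ j → [Q] j * (X i j * X i j)))  ≡⟨ Σℤ-comm n n _ ⟩
    Σℤ n (λ j → Σℤ n (λ i → [Q] j * (X i j * X i j)))  ≡⟨ Σℤ-cong n (λ j → sym (*-distribˡ-Σℤ n ([Q] j) _)) ⟩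
    Σℤ n (λ j → [Q] j * Σℤ n (λ i → X i j * X i j))  ≡⟨ Σℤ-cong n (λ j → cong ([Q] j *_) (column-norm j)) ⟩
    Σℤ n (λ j → [Q] j * k)                        ≡⟨ sym (*-distribʳ-Σℤ n k [Q]) ⟩
    Σℤ n (λ j → [Q] j) * k                        ≡⟨ cong (_* k) (Σℤ-indicator n Q) ⟩
    + count Q * k                                 ∎))
  where
  open ≡-Reasoning
  [P] [Q] : Fin n → ℤ
  [P] i = + indicator (P i)
  [Q] j = + indicator (Q j)
  row-norm : ∀ i → Σℤ n (λ j → X i j * X i j) ≡ k
  row-norm i = trans (XXᵀ≋kI i i) (scalarI-diag k i)
  column-norm : ∀ j → Σℤ n (λ i → X i j * X i j) ≡ k
  column-norm j = trans (weighing-ᵀ X k XXᵀ≋kI j j) (scalarI-diag k j)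
  on-support : ∀ i j → [P] i * (X i j * X i j) ≡ [Q] j * (X i j * X i j)
  on-support i j with X i j ℤ.≟ 0ℤ
  ... | yes ≡0 = trans (vanishes ([P] i)) (sym (vanishes ([Q] j)))
    where
    vanishes : ∀ c → c * (X i j * X i j) ≡ 0ℤ
    vanishes c = trans (cong (λ x → c * (x * x)) ≡0) (ℤP.*-zeroʳ c)
  ... | no  ≢0 = cong (λ b → + indicator b * (X i j * X i j)) (sep i j ≢0)

primitive⇒labelling-constant :
  ∀ {n k} {X : Mat n n} → k ≢ 0ℤ → (X · (X ᵀ)) ≋ scalarI k → Primitive X →
  ∀ {T : Set} → DecidableEquality T → (f g : Fin n → T) → (∀ i j → X i j ≢ 0ℤ → f i ≡ g j) →
  ∀ i₀ → (∀ i → f i ≡ f i₀) × (∀ j → g j ≡ f i₀)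
primitive⇒labelling-constant {n} {X = X} k≢0 XXᵀ≋kI prim _≟_ f g f≡g i₀ =
  (λ i → does-true (f i ≟ f i₀) (count≡n⇒true P #P≡n i)) ,
  (λ j → does-true (g j ≟ f i₀) (count≡n⇒true Q (trans (sym #P≡#Q) #P≡n) j))
  where
  P Q : Fin n → Bool
  P i = Dec.does (f i ≟ f i₀)
  Q j = Dec.does (g j ≟ f i₀)
  sep : Separates X P Q
  sep i j ≢0 = cong (λ t → Dec.does (t ≟ f i₀)) (f≡g i j ≢0)
  #P≡#Q : count P ≡ count Q
  #P≡#Q = separates⇒count≡ k≢0 XXᵀ≋kI sep
  #P≡n : count P ≡ n
  #P≡n with ℕP.m≤n⇒m<n∨m≡n (count≤n P)
  ... | inj₂ #P≡n = #P≡n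
  ... | inj₁ #P<n = ⊥-elim (separation⇒¬primitive S prim)
    where
    S : Separation X (count P)
    S = record
      { rowPart = P ; colPart = Q ; separates = sep
      ; count-rowPart = refl ; count-colPart = sym #P≡#Q
      ; 1≤c = true⇒count-pos P (Dec.dec-true (f i₀ ≟ f i₀) refl) ; c<n = #P<n }
  does-true : ∀ {A : Set} (a? : Dec A) → Dec.does a? ≡ true → A
  does-true (yes a) _ = a

data PrimWeighingView {n} (X : Mat n n) : Set where
  zero1×1  : n ≡ 1 → IsZero X → PrimWeighingView X
  weight≢0 : ∀ {k} → k ≢ 0ℤ → (X · (X ᵀ)) ≋ scalarI k → PrimWeighingView X

primitive-zero⇒1×1 : ∀ {n} {X : Mat n n} → Primitive X → IsZero X → n ≡ 1
primitive-zero⇒1×1 {suc zero}    _    _     = refl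
primitive-zero⇒1×1 {suc (suc n)} prim X≡0 = ⊥-elim (separation⇒¬primitive S prim)
  where
  isFirst : Fin (suc (suc n)) → Bool
  isFirst zero    = true
  isFirst (suc _) = false
  S : Separation _ 1
  S = record
    { rowPart = isFirst ; colPart = isFirst ; separates = λ i j ≢0 → ⊥-elim (≢0 (X≡0 i j))
    ; count-rowPart = cong suc (count-false (suc n)) ; count-colPart = cong suc (count-false (suc n))
    ; 1≤c = s≤s z≤n ; c<n = s≤s (s≤s z≤n) }

primWeighingView : ∀ {n} {X : Mat n n} → IsWeighing X → Primitive X → PrimWeighingView X
primWeighingView (k , XXᵀ≋kI) prim with k ℤ.≟ 0ℤ
... | yes refl = zero1×1 (primitive-zero⇒1×1 prim (weight0⇒zero XXᵀ≋kI)) (weight0⇒zero XXᵀ≋kI)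
... | no  k≢0  = weight≢0 k≢0 XXᵀ≋kI

-- Existence of a primitive decomposition

⊕-primitiveˡ : ∀ {n c d} {A : Mat n n} {X : Mat c c} {Y : Mat d d} → A ≃H (X ⊕ Y) → 1 ℕ.≤ c →
               (∀ c′ → c′ ℕ.< c → ¬ Separation A c′) → Primitive X
⊕-primitiveˡ {X = X} {Y} E 1≤c no-smaller = ¬separation⇒primitive 1≤c λ c′ S →
  no-smaller c′ (c<n S) (separation-≃H (≃H-sym E) (separation-⊕ˡ X Y S))

least-or-none : ∀ {R : ℕ → Set} → (∀ c → Dec (R c)) → ∀ N →
                (∃ λ c → R c × (∀ c′ → c′ ℕ.< c → ¬ R c′)) ⊎ (∀ c → c ℕ.< N → ¬ R c)
least-or-none R? zero = inj₂ (λ _ ())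
least-or-none R? (suc N) with least-or-none R? N
... | inj₁ least = inj₁ least
... | inj₂ none with R? N
...   | yes RN  = inj₁ (N , RN , none)
...   | no  ¬RN = inj₂ λ c c<1+N → case ℕP.m≤n⇒m<n∨m≡n (ℕP.≤-pred c<1+N) of λ where
          (inj₁ c<N)  → none c c<N
          (inj₂ refl) → ¬RN

Decomposition : ∀ {n} → Mat n n → Set
Decomposition A = Σ ℕ λ r → Σ (Fin r → Block) λ bs → (∀ i → PrimWeighing (bs i)) × (A ≃H ⨁ r bs)

decomposition : ∀ n (A : Mat n n) → IsWeighing A → Decomposition A
decomposition = <-rec _ step
  where
  step : ∀ n → (∀ {d} → d ℕ.< n → (Y : Mat d d) → IsWeighing Y → Decomposition Y) →
         (A : Mat n n) → IsWeighing A → Decomposition A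
  step zero    _   A W = 0 , (λ ()) , (λ ()) , ≃H-empty A _
  step (suc n) rec A W with least-or-none (separation? A) (suc n)
  ... | inj₂ unseparated = 1 , (λ _ → suc n , A)
                         , (λ _ → W , ¬separation⇒primitive (s≤s z≤n) (λ c S → unseparated c (c<n S) S))
                         , ⊕-emptyʳ A _
  ... | inj₁ (c , S , no-smaller) =
    let open Splitting (separation⇒splitting S)
        W-left , W-right = isWeighing-⊕ left right (isWeighing-≃H ≃left⊕right W)
        r , bs , prim , right≃⨁bs = rec (subst (d ℕ.<_) c+d≡n (ℕP.+-monoˡ-≤ d (1≤c S))) right W-right
    in suc r , (c , left) ∷ bs
     , (λ { zero → W-left , ⊕-primitiveˡ ≃left⊕right (1≤c S) no-smaller ; (suc i) → prim i })
     , ≃H-trans ≃left⊕right (⊕-cong ≃H-refl right≃⨁bs)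

existence : (n : ℕ) (A : Mat n n) → IsWeighing A →
            Σ ℕ λ r → Σ (Fin r → Block) λ bs → (∀ i → PrimWeighing (bs i)) × (A ∼H′ ⨁ r bs)
existence n A W = let r , bs , prim , A≃⨁ = decomposition n A W in r , bs , prim , ≃H⇒∼H′ A≃⨁

-- Uniqueness of the primitive decomposition

Fin1-unique : ∀ {n} → n ≡ 1 → (i j : Fin n) → i ≡ j
Fin1-unique refl zero zero = refl

toPermutation′ : ∀ {r s} (π : Permutation r s) →
                 Σ (r ≡ s) λ e → Σ (Permutation′ r) λ π′ → ∀ i → cast e (π′ ⟨$⟩ʳ i) ≡ π ⟨$⟩ʳ i
toPermutation′ π = e , π Perm.∘ₚ Perm.cast-id (sym e)
                 , λ i → trans (FP.cast-trans (sym e) e _) (FP.cast-is-id _ _)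
  where e = Perm.↔⇒≡ π

module _ {r s} (bs : Fin r → Block) (bs′ : Fin s → Block)
         (π : Permutation (totalSize s bs′) (totalSize r bs)) {a b}
         (into : ∀ j → blockOf r bs (π ⟨$⟩ʳ embed s bs′ b j) ≡ a)
         (back : ∀ i → blockOf s bs′ (π ⟨$⟩ˡ embed r bs a i) ≡ b) where

  private
    to : ∀ j → Σ (Fin (size (bs a))) λ i → embed r bs a i ≡ π ⟨$⟩ʳ embed s bs′ b j
    to j = blockOf⇒embed r bs _ a (into j)
    from : ∀ i → Σ (Fin (size (bs′ b))) λ j → embed s bs′ b j ≡ π ⟨$⟩ˡ embed r bs a i
    from i = blockOf⇒embed s bs′ _ b (back i)

  restrict : Permutation (size (bs′ b)) (size (bs a))
  restrict = permutation (proj₁ ∘ to) (proj₁ ∘ from)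
    (λ i → embed-injectiveʳ r bs a _ _ (begin
      embed r bs a (proj₁ (to (proj₁ (from i))))  ≡⟨ proj₂ (to _) ⟩
      π ⟨$⟩ʳ embed s bs′ b (proj₁ (from i))       ≡⟨ cong (π ⟨$⟩ʳ_) (proj₂ (from i)) ⟩
      π ⟨$⟩ʳ (π ⟨$⟩ˡ embed r bs a i)               ≡⟨ Perm.inverseʳ π ⟩
      embed r bs a i                               ∎))
    (λ j → embed-injectiveʳ s bs′ b _ _ (begin
      embed s bs′ b (proj₁ (from (proj₁ (to j))))  ≡⟨ proj₂ (from _) ⟩
      π ⟨$⟩ˡ embed r bs a (proj₁ (to j))           ≡⟨ cong (π ⟨$⟩ˡ_) (proj₂ (to j)) ⟩
      π ⟨$⟩ˡ (π ⟨$⟩ʳ embed s bs′ b j)              ≡⟨ Perm.inverseˡ π ⟩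
      embed s bs′ b j                               ∎))
    where open ≡-Reasoning

  restrict-embed : ∀ j → embed r bs a (restrict ⟨$⟩ʳ j) ≡ π ⟨$⟩ʳ embed s bs′ b j
  restrict-embed j = proj₂ (to j)

≃H-restrict : ∀ {r s} {bs : Fin r → Block} {bs′ : Fin s → Block} (E : ⨁ r bs ≃H ⨁ s bs′) a b →
  let ρ = perm (rows E) ; γ = perm (cols E) in
  (∀ i → blockOf r bs (ρ ⟨$⟩ʳ embed s bs′ b i) ≡ a) → (∀ i → blockOf s bs′ (ρ ⟨$⟩ˡ embed r bs a i) ≡ b) →
  (∀ j → blockOf r bs (γ ⟨$⟩ʳ embed s bs′ b j) ≡ a) → (∀ j → blockOf s bs′ (γ ⟨$⟩ˡ embed r bs a j) ≡ b) →
  mat (bs a) ≃H mat (bs′ b)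
≃H-restrict {r} {s} {bs} {bs′} E a b ρ-into ρ-back γ-into γ-back = record
  { rows = blockwise (rows E) ρ-into ρ-back ; cols = blockwise (cols E) γ-into γ-back ; transforms = entries }
  where
  blockwise : (σ : SignedPerm (totalSize s bs′) (totalSize r bs)) →
              (∀ i → blockOf r bs (perm σ ⟨$⟩ʳ embed s bs′ b i) ≡ a) →
              (∀ i → blockOf s bs′ (perm σ ⟨$⟩ˡ embed r bs a i) ≡ b) → SignedPerm (size (bs′ b)) (size (bs a))
  blockwise σ into back = record
    { perm = restrict bs bs′ (perm σ) into back
    ; sign = sign σ ∘ embed s bs′ b
    ; isSign = isSign σ ∘ embed s bs′ b }
  entries : mat (bs′ b) ≋
            transform (blockwise (rows E) ρ-into ρ-back) (blockwise (cols E) γ-into γ-back) (mat (bs a))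
  entries i j = begin
    mat (bs′ b) i j                                 ≡⟨ sym (⨁-embed s bs′ b i j) ⟩
    ⨁ s bs′ (embed s bs′ b i) (embed s bs′ b j)     ≡⟨ transforms E _ _ ⟩
    ± (⨁ r bs (perm (rows E) ⟨$⟩ʳ embed s bs′ b i) (perm (cols E) ⟨$⟩ʳ embed s bs′ b j))
      ≡⟨ cong₂ (λ p q → ± (⨁ r bs p q)) (sym (restrict-embed bs bs′ (perm (rows E)) ρ-into ρ-back i))
                                        (sym (restrict-embed bs bs′ (perm (cols E)) γ-into γ-back j)) ⟩
    ± (⨁ r bs (embed r bs a _) (embed r bs a _))    ≡⟨ cong ± (⨁-embed r bs a _ _) ⟩
    ± (mat (bs a) _ _)                              ∎
    where
    open ≡-Reasoning
    ± : ℤ → ℤ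
    ± x = sign (rows E) (embed s bs′ b i) * (sign (cols E) (embed s bs′ b j) * x)

-- E sends the rows of each block b on the right into the single block match b on the left.
module BlockMatching {r s} {bs : Fin r → Block} {bs′ : Fin s → Block}
       (prim : ∀ a → PrimWeighing (bs a)) (prim′ : ∀ b → PrimWeighing (bs′ b))
       (E : ⨁ r bs ≃H ⨁ s bs′) where

  ρ γ : Fin (totalSize s bs′) → Fin (totalSize r bs)
  ρ = perm (rows E) ⟨$⟩ʳ_
  γ = perm (cols E) ⟨$⟩ʳ_

  view : ∀ b → PrimWeighingView (mat (bs′ b))
  view b = primWeighingView (proj₁ (prim′ b)) (proj₂ (prim′ b))

  origin : ∀ b → Fin (size (bs′ b))
  origin b = F.fromℕ< (proj₁ (proj₂ (prim′ b)))

  match : Fin s → Fin r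
  match b = blockOf r bs (ρ (embed s bs′ b (origin b)))

  module _ b {k} (k≢0 : k ≢ 0ℤ) (W : (mat (bs′ b) · (mat (bs′ b) ᵀ)) ≋ scalarI k) where
    support-constant : (∀ i → blockOf r bs (ρ (embed s bs′ b i)) ≡ match b)
                     × (∀ j → blockOf r bs (γ (embed s bs′ b j)) ≡ match b)
    support-constant = primitive⇒labelling-constant k≢0 W (proj₂ (prim′ b)) F._≟_
      (λ i → blockOf r bs (ρ (embed s bs′ b i))) (λ j → blockOf r bs (γ (embed s bs′ b j)))
      (λ i j ≢0 → ⨁-nonzero⇒blockOf≡ r bs _ _
         (≃H-nonzero E _ _ (≢0 ∘ trans (sym (⨁-embed s bs′ b i j)))))
      (origin b)

  rows-match : ∀ b i → blockOf r bs (ρ (embed s bs′ b i)) ≡ match b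
  rows-match b i with view b
  ... | zero1×1 size≡1 _ = cong (λ i → blockOf r bs (ρ (embed s bs′ b i))) (Fin1-unique size≡1 i (origin b))
  ... | weight≢0 k≢0 W  = proj₁ (support-constant b k≢0 W) i

  match-zero : ∀ b → IsZero (mat (bs′ b)) → (size (bs (match b)) ≡ 1) × IsZero (mat (bs (match b)))
  match-zero b block≡0 with primWeighingView (proj₁ (prim (match b))) (proj₂ (prim (match b)))
  ... | zero1×1 size≡1 X≡0 = size≡1 , X≡0
  ... | weight≢0 k≢0 W     = ⊥-elim (weight≢0⇒row≢0 {X = mat (bs (match b))} k≢0 W i λ l → begin
    mat (bs a) i l                          ≡⟨ sym (⨁-embed r bs a i l) ⟩
    ⨁ r bs (embed r bs a i) (embed r bs a l)  ≡⟨ cong (λ p → ⨁ r bs p (embed r bs a l)) (proj₂ located) ⟩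
    ⨁ r bs (ρ x) (embed r bs a l)           ≡⟨ ≃H-zero-row E x (⨁-zero-row s bs′ b block≡0 (origin b)) _ ⟩
    0ℤ                                      ∎)
    where
    open ≡-Reasoning
    a = match b
    x = embed s bs′ b (origin b)
    located : Σ (Fin (size (bs a))) λ i → embed r bs a i ≡ ρ x
    located = blockOf⇒embed r bs (ρ x) a refl
    i = proj₁ located

module Uniqueness {r s} {bs : Fin r → Block} {bs′ : Fin s → Block}
       (prim : ∀ a → PrimWeighing (bs a)) (prim′ : ∀ b → PrimWeighing (bs′ b))
       (E : ⨁ r bs ≃H ⨁ s bs′) where

  module M  = BlockMatching prim prim′ E
  module M′ = BlockMatching prim′ prim (≃H-sym E)

  match-retract : ∀ b → M′.match (M.match b) ≡ b
  match-retract b = begin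
    M′.match a                                      ≡⟨ sym (M′.rows-match a i) ⟩
    blockOf s bs′ (ρ ⟨$⟩ˡ embed r bs a i)           ≡⟨ cong (λ p → blockOf s bs′ (ρ ⟨$⟩ˡ p)) (proj₂ located) ⟩
    blockOf s bs′ (ρ ⟨$⟩ˡ (ρ ⟨$⟩ʳ x))               ≡⟨ cong (blockOf s bs′) (Perm.inverseˡ ρ) ⟩
    blockOf s bs′ x                                 ≡⟨ blockOf-embed s bs′ b (M.origin b) ⟩
    b                                               ∎
    where
    open ≡-Reasoning
    ρ = perm (rows E)
    a = M.match b
    x = embed s bs′ b (M.origin b)
    located : Σ (Fin (size (bs a))) λ i → embed r bs a i ≡ ρ ⟨$⟩ʳ x
    located = blockOf⇒embed r bs (ρ ⟨$⟩ʳ x) a refl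
    i = proj₁ located

  block≃ : ∀ b → mat (bs (M.match b)) ≃H mat (bs′ b)
  block≃ b with M.view b
  ... | zero1×1 size≡1 b≡0 = let size′≡1 , a≡0 = M.match-zero b b≡0 in zero-≃H size′≡1 size≡1 a≡0 b≡0
  ... | weight≢0 k≢0 W with M′.view (M.match b)
  ...   | weight≢0 k′≢0 W′ = ≃H-restrict E (M.match b) b
            (M.rows-match b) (λ i → trans (M′.rows-match (M.match b) i) (match-retract b))
            (proj₂ (M.support-constant b k≢0 W))
            (λ j → trans (proj₂ (M′.support-constant (M.match b) k′≢0 W′) j) (match-retract b))
  ...   | zero1×1 _ a≡0 = ⊥-elim (weight≢0⇒row≢0 {X = mat (bs′ b)} k≢0 W (M.origin b) (proj₂ b-zero (M.origin b)))
    where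
    b-zero : (size (bs′ b) ≡ 1) × IsZero (mat (bs′ b))
    b-zero = subst (λ b → (size (bs′ b) ≡ 1) × IsZero (mat (bs′ b))) (match-retract b)
                   (M′.match-zero (M.match b) a≡0)

uniqueness : (r s : ℕ) (bs : Fin r → Block) (bs′ : Fin s → Block) →
             (∀ i → PrimWeighing (bs i)) → (∀ j → PrimWeighing (bs′ j)) →
             ⨁ r bs ∼H′ ⨁ s bs′ →
             Σ (r ≡ s) λ e → Σ (Permutation′ r) λ π →
               ∀ i → mat (bs i) ∼H′ mat (bs′ (cast e (π ⟨$⟩ʳ i)))
uniqueness r s bs bs′ prim prim′ ⨁∼⨁′ =
  let e , π , cast-π = toPermutation′ matching
  in e , π , λ a → subst (λ b → mat (bs a) ∼H′ mat (bs′ b)) (sym (cast-π a)) (matched a)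
  where
  E : ⨁ r bs ≃H ⨁ s bs′
  E = ∼H′⇒≃H ⨁∼⨁′
  module U  = Uniqueness prim prim′ E
  module U′ = Uniqueness prim′ prim (≃H-sym E)
  matching : Permutation r s
  matching = permutation U.M′.match U.M.match U.match-retract U′.match-retract
  matched : ∀ a → mat (bs a) ∼H′ mat (bs′ (matching ⟨$⟩ʳ a))
  matched a = ≃H⇒∼H′ (≃H-sym (U′.block≃ a))

theorem4p6 :
    ((n : ℕ) (A : Mat n n) → IsWeighing A →
      Σ ℕ λ r → Σ (Fin r → Block) λ bs →
        (∀ i → PrimWeighing (bs i)) × (A ∼H′ ⨁ r bs))
    ×
    ((r s : ℕ) (bs : Fin r → Block) (bs′ : Fin s → Block) →
      (∀ i → PrimWeighing (bs i)) → (∀ j → PrimWeighing (bs′ j)) →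
      ⨁ r bs ∼H′ ⨁ s bs′ →
      Σ (r ≡ s) λ e → Σ (Permutation′ r) λ π →
        ∀ i → mat (bs i) ∼H′ mat (bs′ (cast e (π ⟨$⟩ʳ i))))
theorem4p6 = existence , uniqueness
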